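{- A positive integer $x>1$ is a $\tau_{11}$-atom if and only if one of the following holds: (I) $x$ is prime; (II) $x=11p_1\cdots p_k$ with $k\ge0$ and each $p_i$ a prime different from $11$; (III) $11\nmid x$ and the multiset $T(x)$ of class indices of the prime factors of $x$ (counted with multiplicity) has one of the following forms, where $0^k$ denotes $k\ge 0$ copies of $0$, $i,j\in\{1,2,3,4\}$, and all arithmetic on indices is modulo $5$: (a) $\{0^k, i\}$; (b) $\{i,j\}$ with $i\neq j$; (c) $\{0^k,i,j\}$ with $i\neq j$ and $i+j\not\equiv 0$; (d) $\{i,i,j\}$ with $i\neq j$ and $2i\not\equiv j$; (e) $\{0^k,i,i,j\}$ with $i\neq j$, $2i\not\equiv j$ and $2i+j\not\equiv 0$; (f) $\{i,i,i,r\}$ where $r\in\{1,2,3,4\}$, $r\equiv 2i \pmod 5$.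
   Context: For a positive integer $n$ and integers $x,y$, write $x\,\tau_n\,y$ if $x\equiv y \pmod n$. For a nonzero nonunit integer $x$, a $\tau_n$-factorization of $x$ is an expression $x=\lambda a_1a_2\cdots a_k$ with $\lambda\in\{1,-1\}$, each $a_i$ a nonzero nonunit integer (i.e. $a_i\neq 0,\pm1$), and $a_i\equiv a_j \pmod n$ for all $i,j$; it is proper if $k>1$. A nonzero nonunit integer $x$ is a $\tau_n$-atom if it has no proper $\tau_n$-factorization. "Prime" means a positive prime number. For $r\in\{0,1,2,3,4\}$, a prime $p\neq 11$ has class index $r$ if $p\equiv 2^r$ or $p\equiv -2^r\pmod{11}$; thus index $0$ means $p\equiv\pm1$, index $1$ means $p\equiv\pm2$, index $2$ means $p\equiv\pm4$, index $3$ means $p\equiv\pm3$, index $4$ means $p\equiv\pm5 \pmod{11}$. -}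

module Defs where

open import Data.Nat as ℕ using (ℕ; _≤_; _<_; _%_; _^_)
open import Data.Nat.Primality using (Prime)
open import Data.Nat.Divisibility using (_∣_)
open import Data.Integer as ℤ using (ℤ; +_; _-_; _+_; -_)
open import Data.Integer.Divisibility as ℤD using ()
open import Data.List using (List; []; _∷_; _++_; replicate; length)
open import Data.List.Relation.Unary.All using (All)
open import Data.List.Relation.Binary.Pointwise using (Pointwise)
open import Data.List.Relation.Binary.Permutation.Propositional using (_↭_)
open import Data.Product using (_×_; ∃; ∃-syntax; Σ-syntax)
open import Data.Sum using (_⊎_)
open import Relation.Binary.PropositionalEquality using (_≡_; _≢_)
open import Relation.Nullary using (¬_)

import Data.List as L

prodℤ : List ℤ → ℤ
prodℤ = L.foldr ℤ._*_ (+ 1)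

prodℕ : List ℕ → ℕ
prodℕ = L.foldr ℕ._*_ 1

_τ[_]_ : ℤ → ℕ → ℤ → Set
x τ[ n ] y = (+ n) ℤD.∣ (x - y)

NonzeroNonunit : ℤ → Set
NonzeroNonunit a = (a ≢ + 0) × (a ≢ + 1) × (a ≢ - (+ 1))

-- a τ_n-factorization  x = λ a₁ ⋯ a_k  (λ = ±1) given by the list as = a₁ ∷ … ∷ a_k
TauFactorization : ℕ → ℤ → List ℤ → Set
TauFactorization n x as =
  ((x ≡ prodℤ as) ⊎ (x ≡ - prodℤ as))
  × All NonzeroNonunit as
  × All (λ a → All (λ b → a τ[ n ] b) as) as

ProperTauFactorization : ℕ → ℤ → List ℤ → Set
ProperTauFactorization n x as = TauFactorization n x as × 1 < length as

TauAtom : ℕ → ℤ → Set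
TauAtom n x = NonzeroNonunit x × ¬ (∃[ as ] ProperTauFactorization n x as)

HasClassIndex : ℕ → ℕ → Set
HasClassIndex p r = r ≤ 4 × ((+ p) τ[ 11 ] (+ (2 ^ r)) ⊎ (+ p) τ[ 11 ] (- (+ (2 ^ r))))

_≡₅_ : ℕ → ℕ → Set
a ≡₅ b = a % 5 ≡ b % 5

NonzeroIdx : ℕ → Set
NonzeroIdx i = 1 ≤ i × i ≤ 4

zeros : ℕ → List ℕ
zeros k = replicate k 0

data Shape : List ℕ → Set where
  form-a : ∀ k i → NonzeroIdx i → Shape (zeros k ++ i ∷ [])
  form-b : ∀ i j → NonzeroIdx i → NonzeroIdx j → i ≢ j → Shape (i ∷ j ∷ [])
  form-c : ∀ k i j → NonzeroIdx i → NonzeroIdx j → i ≢ j → ¬ ((i ℕ.+ j) ≡₅ 0)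
         → Shape (zeros k ++ i ∷ j ∷ [])
  form-d : ∀ i j → NonzeroIdx i → NonzeroIdx j → i ≢ j → ¬ ((2 ℕ.* i) ≡₅ j)
         → Shape (i ∷ i ∷ j ∷ [])
  form-e : ∀ k i j → NonzeroIdx i → NonzeroIdx j → i ≢ j → ¬ ((2 ℕ.* i) ≡₅ j)
         → ¬ ((2 ℕ.* i ℕ.+ j) ≡₅ 0)
         → Shape (zeros k ++ i ∷ i ∷ j ∷ [])
  form-f : ∀ i r → NonzeroIdx i → NonzeroIdx r → r ≡₅ (2 ℕ.* i)
         → Shape (i ∷ i ∷ i ∷ r ∷ [])

CaseII : ℕ → Set
CaseII x = ∃[ ps ] (All (λ p → Prime p × p ≢ 11) ps × x ≡ 11 ℕ.* prodℕ ps)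

-- T(x) is given by a prime
-- factorisation ps of x and the list rs of the class indices of its entries.
CaseIII : ℕ → Set
CaseIII x = ¬ (11 ∣ x) ×
  ∃[ ps ] ∃[ rs ] ∃[ ms ]
    (All Prime ps × prodℕ ps ≡ x × Pointwise HasClassIndex ps rs × rs ↭ ms × Shape ms)

-- Reduce modulo ±1: (ℤ/11)ˣ/{±1} is cyclic of order 5, generated by 2, and the class index
-- of p ≢ 0 (mod 11) is the discrete logarithm of ±p.  Since every factor of a τ₁₁-
-- factorization may be replaced by its negative, factors only need a common class index, and
-- the class index is additive.  Hence for 11 ∤ x a proper τ₁₁-factorization of x is the same as
-- a splitting of the multiset T(x) of class indices of the prime factors into at least two
-- nonempty blocks with equal sums modulo 5 (factorization⇒split and split⇒factorization).
-- The heart of the proof is the purely combinatorial statement that a multiset of at least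
-- two indices has no such splitting iff it has one of the forms (a)–(f).  It is proved by
-- finite checks evaluated by Agda, together with two reductions: zeros only matter through
-- whether there are any (they can join any block), and six or more nonzero indices always
-- split (some at most five of them sum to half the total).  Multiples of 11 are handled
-- directly: x = 11y is an atom iff 11 ∤ y, since 11 divides all factors as soon as it
-- divides one.

module Submission where

open import Data.Nat
open import Data.Nat.Properties
open import Data.Nat.DivMod using (_%_; _/_; m%n<n; m≡m%n+[m/n]*n; m%n%n≡m%n; %-distribˡ-+; %-distribˡ-*)
open import Data.Nat.Divisibility
  using (_∣_; divides; ∣-trans; ∣-refl; ∣⇒≤; ∣1⇒≡1; m∣m*n; *-pres-∣; *-cancelˡ-∣; _∣?_; m%n≡0⇒n∣m; n∣m⇒m%n≡0)
open import Data.Nat.Primality using (Prime; euclidsLemma; prime?; prime⇒irreducible; productOfPrimes≥1; ¬prime[1])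
open import Data.Nat.Primality.Factorisation using (PrimeFactorisation; factorise; factorisationUnique)
open import Data.Nat.ListAction.Properties using (product-↭; product-++; ∈⇒∣product)
open import Data.Nat.Tactic.RingSolver using (solve-∀)
open import Data.Integer as ℤ using (ℤ; +_; -[1+_]; -_; ∣_∣)
import Data.Integer.Properties as ℤ
import Data.Integer.Divisibility.Signed as Signed
import Data.Integer.Tactic.RingSolver as ℤSolver
open import Data.Bool using (Bool; true; false; _∧_; _∨_; not; T)
open import Data.Bool.Properties using (T-∧; T-∨)
open import Data.Product using (_×_; _,_; Σ; ∃-syntax; proj₁; proj₂)
open import Data.Sum using (_⊎_; inj₁; inj₂; map₂)
open import Data.Empty using (⊥-elim)
open import Data.List using (List; []; _∷_; _++_; replicate; length; map; concat)
open import Data.List.Properties using (length-++; length-replicate; length-map; map-++)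
open import Data.List.Relation.Unary.All as All using (All; []; _∷_)
import Data.List.Relation.Unary.All.Properties as All
open import Data.List.Relation.Unary.All.Properties using (All¬⇒¬Any)
open import Data.List.Relation.Unary.Any as Any using (Any; here; there)
import Data.List.Relation.Unary.Any.Properties as AnyP
open import Data.List.Relation.Binary.Pointwise using (Pointwise; []; _∷_)
open import Data.List.Relation.Binary.Permutation.Propositional
  using (_↭_; prep; swap; ↭-sym) renaming (refl to ↭-refl; trans to ↭-trans)
import Data.List.Relation.Binary.Permutation.Propositional.Properties as Perm
open Perm using (shift; ++⁺ˡ)
open import Relation.Binary.PropositionalEquality
open import Relation.Nullary using (¬_; Dec; yes; no)
open import Relation.Nullary.Decidable using (T?; toWitness)
open import Function.Bundles using (_⇔_; mk⇔; module Equivalence)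
open import Defs

open Equivalence using (to; from)

_⇒ᵇ_ : Bool → Bool → Bool
a ⇒ᵇ b = not a ∨ b

⇒ᵇ-elim : ∀ {a b} → T (a ⇒ᵇ b) → T a → T b
⇒ᵇ-elim {true} h _ = h

T-not : ∀ {b} → T b → ¬ T (not b)
T-not {true} _ ()

allBelow : ℕ → (ℕ → Bool) → Bool
allBelow zero    f = true
allBelow (suc n) f = f n ∧ allBelow n f

anyBelow : ℕ → (ℕ → Bool) → Bool
anyBelow zero    f = false
anyBelow (suc n) f = anyBelow n f ∨ f n

allBelow-sound : ∀ n f → T (allBelow n f) → ∀ i → i < n → T (f i)
allBelow-sound (suc n) f h i i<1+n with to (T-∧ {f n}) h | m≤n⇒m<n∨m≡n (s≤s⁻¹ i<1+n)
... | _  , rest | inj₁ i<n  = allBelow-sound n f rest i i<n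
... | fn , _    | inj₂ refl = fn

anyBelow-sound : ∀ n f → T (anyBelow n f) → Σ ℕ λ i → i < n × T (f i)
anyBelow-sound (suc n) f h with to (T-∨ {anyBelow n f}) h
... | inj₂ fn = n , ≤-refl , fn
... | inj₁ h′ with anyBelow-sound n f h′
...   | i , i<n , fi = i , m≤n⇒m≤1+n i<n , fi

anyBelow-complete : ∀ n f i → i < n → T (f i) → T (anyBelow n f)
anyBelow-complete (suc n) f i i<1+n fi with m≤n⇒m<n∨m≡n (s≤s⁻¹ i<1+n)
... | inj₁ i<n  = from T-∨ (inj₁ (anyBelow-complete n f i i<n fi))
... | inj₂ refl = from (T-∨ {anyBelow n f}) (inj₂ fi)

¬T⇒T-not : ∀ {b} → ¬ T b → T (not b)
¬T⇒T-not {false} _ = _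
¬T⇒T-not {true}  h = h _

-- A multiset of class indices, recorded by its multiplicities n₀ … n₄ of 0 … 4.
data Counts : Set where
  mkCounts : (n₀ n₁ n₂ n₃ n₄ : ℕ) → Counts

infixl 6 _⊕_ _⊖_
infix 4 _≼_

_⊕_ : Counts → Counts → Counts
mkCounts a b c d e ⊕ mkCounts a′ b′ c′ d′ e′ = mkCounts (a + a′) (b + b′) (c + c′) (d + d′) (e + e′)

_⊖_ : Counts → Counts → Counts
mkCounts a b c d e ⊖ mkCounts a′ b′ c′ d′ e′ = mkCounts (a ∸ a′) (b ∸ b′) (c ∸ c′) (d ∸ d′) (e ∸ e′)

_≼_ : Counts → Counts → Set
mkCounts a b c d e ≼ mkCounts a′ b′ c′ d′ e′ = a ≤ a′ × b ≤ b′ × c ≤ c′ × d ≤ d′ × e ≤ e′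

∅ : Counts
∅ = mkCounts 0 0 0 0 0

size : Counts → ℕ
size (mkCounts a b c d e) = a + (b + (c + (d + e)))

nonzeroSize : Counts → ℕ
nonzeroSize (mkCounts a b c d e) = b + (c + (d + e))

weight : Counts → ℕ
weight (mkCounts a b c d e) = b + (2 * c + (3 * d + 4 * e))

zeroCount : Counts → ℕ
zeroCount (mkCounts a b c d e) = a

dropZeros : Counts → Counts
dropZeros (mkCounts a b c d e) = mkCounts 0 b c d e

sumCounts : List Counts → Counts
sumCounts []       = ∅
sumCounts (v ∷ vs) = v ⊕ sumCounts vs

cong₅ : ∀ {a b c d e a′ b′ c′ d′ e′} → a ≡ a′ → b ≡ b′ → c ≡ c′ → d ≡ d′ → e ≡ e′ →
        mkCounts a b c d e ≡ mkCounts a′ b′ c′ d′ e′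
cong₅ refl refl refl refl refl = refl

⊕-comm : ∀ u v → u ⊕ v ≡ v ⊕ u
⊕-comm (mkCounts a b c d e) (mkCounts a′ b′ c′ d′ e′) =
  cong₅ (+-comm a a′) (+-comm b b′) (+-comm c c′) (+-comm d d′) (+-comm e e′)

⊕-assoc : ∀ u v w → u ⊕ v ⊕ w ≡ u ⊕ (v ⊕ w)
⊕-assoc (mkCounts a b c d e) (mkCounts a′ b′ c′ d′ e′) (mkCounts a″ b″ c″ d″ e″) =
  cong₅ (+-assoc a a′ a″) (+-assoc b b′ b″) (+-assoc c c′ c″) (+-assoc d d′ d″) (+-assoc e e′ e″)

⊕-identityˡ : ∀ u → ∅ ⊕ u ≡ u
⊕-identityˡ (mkCounts a b c d e) = refl

⊕-identityʳ : ∀ u → u ⊕ ∅ ≡ u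
⊕-identityʳ (mkCounts a b c d e) =
  cong₅ (+-identityʳ a) (+-identityʳ b) (+-identityʳ c) (+-identityʳ d) (+-identityʳ e)

⊕-⊖ : ∀ u c → u ≼ c → u ⊕ (c ⊖ u) ≡ c
⊕-⊖ (mkCounts a b c d e) (mkCounts a′ b′ c′ d′ e′) (p₁ , p₂ , p₃ , p₄ , p₅) =
  cong₅ (m+[n∸m]≡n p₁) (m+[n∸m]≡n p₂) (m+[n∸m]≡n p₃) (m+[n∸m]≡n p₄) (m+[n∸m]≡n p₅)

⊕⊖-cancel : ∀ u v → (u ⊕ v) ⊖ u ≡ v
⊕⊖-cancel (mkCounts a b c d e) (mkCounts a′ b′ c′ d′ e′) =
  cong₅ (m+n∸m≡n a a′) (m+n∸m≡n b b′) (m+n∸m≡n c c′) (m+n∸m≡n d d′) (m+n∸m≡n e e′)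

⊕-cancelˡ : ∀ u v w → u ⊕ v ≡ u ⊕ w → v ≡ w
⊕-cancelˡ u v w eq = trans (sym (⊕⊖-cancel u v)) (trans (cong (_⊖ u) eq) (⊕⊖-cancel u w))

≼-⊕ : ∀ u v → u ≼ u ⊕ v
≼-⊕ (mkCounts a b c d e) (mkCounts a′ b′ c′ d′ e′) =
  m≤m+n a a′ , m≤m+n b b′ , m≤m+n c c′ , m≤m+n d d′ , m≤m+n e e′

≼-trans : ∀ u v w → u ≼ v → v ≼ w → u ≼ w
≼-trans (mkCounts _ _ _ _ _) (mkCounts _ _ _ _ _) (mkCounts _ _ _ _ _)
        (p₁ , p₂ , p₃ , p₄ , p₅) (q₁ , q₂ , q₃ , q₄ , q₅) =
  ≤-trans p₁ q₁ , ≤-trans p₂ q₂ , ≤-trans p₃ q₃ , ≤-trans p₄ q₄ , ≤-trans p₅ q₅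

size-⊕ : ∀ u v → size (u ⊕ v) ≡ size u + size v
size-⊕ (mkCounts a b c d e) (mkCounts a′ b′ c′ d′ e′) = solve-∀′ a b c d e a′ b′ c′ d′ e′
  where
  solve-∀′ : ∀ a b c d e a′ b′ c′ d′ e′ →
    (a + a′) + ((b + b′) + ((c + c′) + ((d + d′) + (e + e′))))
      ≡ (a + (b + (c + (d + e)))) + (a′ + (b′ + (c′ + (d′ + e′))))
  solve-∀′ = solve-∀

weight-⊕ : ∀ u v → weight (u ⊕ v) ≡ weight u + weight v
weight-⊕ (mkCounts a b c d e) (mkCounts a′ b′ c′ d′ e′) = solve-∀′ b c d e b′ c′ d′ e′
  where
  solve-∀′ : ∀ b c d e b′ c′ d′ e′ →
    (b + b′) + (2 * (c + c′) + (3 * (d + d′) + 4 * (e + e′)))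
      ≡ (b + (2 * c + (3 * d + 4 * e))) + (b′ + (2 * c′ + (3 * d′ + 4 * e′)))
  solve-∀′ = solve-∀

zeroCount-⊕ : ∀ u v → zeroCount (u ⊕ v) ≡ zeroCount u + zeroCount v
zeroCount-⊕ (mkCounts _ _ _ _ _) (mkCounts _ _ _ _ _) = refl

dropZeros-⊕ : ∀ u v → dropZeros (u ⊕ v) ≡ dropZeros u ⊕ dropZeros v
dropZeros-⊕ (mkCounts _ _ _ _ _) (mkCounts _ _ _ _ _) = refl

size≡zeros+nonzeros : ∀ v → size v ≡ zeroCount v + nonzeroSize v
size≡zeros+nonzeros (mkCounts _ _ _ _ _) = refl

size≡0⇒∅ : ∀ c → size c ≡ 0 → c ≡ ∅
size≡0⇒∅ (mkCounts zero zero zero zero zero) _ = refl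
size≡0⇒∅ (mkCounts zero zero zero zero (suc e)) ()
size≡0⇒∅ (mkCounts zero zero zero (suc d) e) ()
size≡0⇒∅ (mkCounts zero zero (suc c) d e) ()
size≡0⇒∅ (mkCounts zero (suc b) c d e) ()
size≡0⇒∅ (mkCounts (suc a) b c d e) ()

⊕≡∅ : ∀ u v → u ⊕ v ≡ ∅ → u ≡ ∅ × v ≡ ∅
⊕≡∅ u v eq = size≡0⇒∅ u (m+n≡0⇒m≡0 (size u) size≡0) , size≡0⇒∅ v (m+n≡0⇒n≡0 (size u) size≡0)
  where
  size≡0 : size u + size v ≡ 0
  size≡0 = trans (sym (size-⊕ u v)) (cong size eq)

size-dropZeros : ∀ v → size (dropZeros v) ≡ nonzeroSize v
size-dropZeros (mkCounts _ _ _ _ _) = refl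

weight-dropZeros : ∀ v → weight (dropZeros v) ≡ weight v
weight-dropZeros (mkCounts _ _ _ _ _) = refl

Index : ℕ → Set
Index x = x ≤ 4

unit : ℕ → Counts
unit 0 = mkCounts 1 0 0 0 0
unit 1 = mkCounts 0 1 0 0 0
unit 2 = mkCounts 0 0 1 0 0
unit 3 = mkCounts 0 0 0 1 0
unit 4 = mkCounts 0 0 0 0 1
unit _ = ∅

tally : List ℕ → Counts
tally []      = ∅
tally (x ∷ l) = unit x ⊕ tally l

multiplicity : ℕ → Counts → ℕ
multiplicity 0 (mkCounts a _ _ _ _) = a
multiplicity 1 (mkCounts _ b _ _ _) = b
multiplicity 2 (mkCounts _ _ c _ _) = c
multiplicity 3 (mkCounts _ _ _ d _) = d
multiplicity 4 (mkCounts _ _ _ _ e) = e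
multiplicity _ _                    = 0

size-unit : ∀ {x} → Index x → size (unit x) ≡ 1
size-unit {0} _ = refl
size-unit {1} _ = refl
size-unit {2} _ = refl
size-unit {3} _ = refl
size-unit {4} _ = refl
size-unit {suc (suc (suc (suc (suc _))))} (s≤s (s≤s (s≤s (s≤s ()))))

weight-unit : ∀ {x} → Index x → weight (unit x) ≡ x
weight-unit {0} _ = refl
weight-unit {1} _ = refl
weight-unit {2} _ = refl
weight-unit {3} _ = refl
weight-unit {4} _ = refl
weight-unit {suc (suc (suc (suc (suc _))))} (s≤s (s≤s (s≤s (s≤s ()))))

multiplicity-unit : ∀ {x} → Index x → multiplicity x (unit x) ≡ 1
multiplicity-unit {0} _ = refl
multiplicity-unit {1} _ = refl
multiplicity-unit {2} _ = refl
multiplicity-unit {3} _ = refl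
multiplicity-unit {4} _ = refl
multiplicity-unit {suc (suc (suc (suc (suc _))))} (s≤s (s≤s (s≤s (s≤s ()))))

unit-≼ : ∀ {x} → Index x → ∀ u → 1 ≤ multiplicity x u → unit x ≼ u
unit-≼ {0} _ (mkCounts _ _ _ _ _) h = h , z≤n , z≤n , z≤n , z≤n
unit-≼ {1} _ (mkCounts _ _ _ _ _) h = z≤n , h , z≤n , z≤n , z≤n
unit-≼ {2} _ (mkCounts _ _ _ _ _) h = z≤n , z≤n , h , z≤n , z≤n
unit-≼ {3} _ (mkCounts _ _ _ _ _) h = z≤n , z≤n , z≤n , h , z≤n
unit-≼ {4} _ (mkCounts _ _ _ _ _) h = z≤n , z≤n , z≤n , z≤n , h
unit-≼ {suc (suc (suc (suc (suc _))))} (s≤s (s≤s (s≤s (s≤s ())))) _ _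

multiplicity-⊕ : ∀ x u v → multiplicity x (u ⊕ v) ≡ multiplicity x u + multiplicity x v
multiplicity-⊕ 0 (mkCounts _ _ _ _ _) (mkCounts _ _ _ _ _) = refl
multiplicity-⊕ 1 (mkCounts _ _ _ _ _) (mkCounts _ _ _ _ _) = refl
multiplicity-⊕ 2 (mkCounts _ _ _ _ _) (mkCounts _ _ _ _ _) = refl
multiplicity-⊕ 3 (mkCounts _ _ _ _ _) (mkCounts _ _ _ _ _) = refl
multiplicity-⊕ 4 (mkCounts _ _ _ _ _) (mkCounts _ _ _ _ _) = refl
multiplicity-⊕ (suc (suc (suc (suc (suc _))))) (mkCounts _ _ _ _ _) (mkCounts _ _ _ _ _) = refl

tally-++ : ∀ l₁ l₂ → tally (l₁ ++ l₂) ≡ tally l₁ ⊕ tally l₂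
tally-++ []       l₂ = sym (⊕-identityˡ (tally l₂))
tally-++ (x ∷ l₁) l₂ = trans (cong (unit x ⊕_) (tally-++ l₁ l₂)) (sym (⊕-assoc (unit x) (tally l₁) (tally l₂)))

tally-↭ : ∀ {l₁ l₂} → l₁ ↭ l₂ → tally l₁ ≡ tally l₂
tally-↭ ↭-refl         = refl
tally-↭ (prep x p)     = cong (unit x ⊕_) (tally-↭ p)
tally-↭ {x ∷ y ∷ l₁} {_ ∷ _ ∷ l₂} (swap x y p) = begin
  unit x ⊕ (unit y ⊕ tally l₁) ≡⟨ sym (⊕-assoc (unit x) (unit y) (tally l₁)) ⟩
  unit x ⊕ unit y ⊕ tally l₁   ≡⟨ cong₂ _⊕_ (⊕-comm (unit x) (unit y)) (tally-↭ p) ⟩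
  unit y ⊕ unit x ⊕ tally l₂   ≡⟨ ⊕-assoc (unit y) (unit x) (tally l₂) ⟩
  unit y ⊕ (unit x ⊕ tally l₂) ∎
  where open ≡-Reasoning
tally-↭ (↭-trans p q)  = trans (tally-↭ p) (tally-↭ q)

tally-zeros : ∀ k l → tally (zeros k ++ l) ≡ mkCounts k 0 0 0 0 ⊕ tally l
tally-zeros zero    l = sym (⊕-identityˡ (tally l))
tally-zeros (suc k) l = begin
  unit 0 ⊕ tally (zeros k ++ l)              ≡⟨ cong (unit 0 ⊕_) (tally-zeros k l) ⟩
  unit 0 ⊕ (mkCounts k 0 0 0 0 ⊕ tally l)   ≡⟨ sym (⊕-assoc (unit 0) _ (tally l)) ⟩
  mkCounts (suc k) 0 0 0 0 ⊕ tally l        ∎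
  where open ≡-Reasoning

size-tally : ∀ {l} → All Index l → size (tally l) ≡ length l
size-tally {[]}    []         = refl
size-tally {x ∷ l} (ix ∷ il) = begin
  size (unit x ⊕ tally l)          ≡⟨ size-⊕ (unit x) (tally l) ⟩
  size (unit x) + size (tally l)   ≡⟨ cong₂ _+_ (size-unit ix) (size-tally il) ⟩
  suc (length l)                   ∎
  where open ≡-Reasoning

nonzeroList : Counts → List ℕ
nonzeroList (mkCounts _ b c d e) = replicate b 1 ++ (replicate c 2 ++ (replicate d 3 ++ replicate e 4))

canonical : Counts → List ℕ
canonical c = zeros (zeroCount c) ++ nonzeroList c

nonzeroList-nonzero : ∀ c → All NonzeroIdx (nonzeroList c)
nonzeroList-nonzero (mkCounts _ b c d e) =
  All.++⁺ (All.replicate⁺ b (s≤s z≤n , s≤s z≤n))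
  (All.++⁺ (All.replicate⁺ c (s≤s z≤n , s≤s (s≤s z≤n)))
  (All.++⁺ (All.replicate⁺ d (s≤s z≤n , s≤s (s≤s (s≤s z≤n))))
           (All.replicate⁺ e (s≤s z≤n , s≤s (s≤s (s≤s (s≤s z≤n)))))))

length-nonzeroList : ∀ c → length (nonzeroList c) ≡ nonzeroSize c
length-nonzeroList (mkCounts _ b c d e) = begin
  length (replicate b 1 ++ (replicate c 2 ++ (replicate d 3 ++ replicate e 4)))
    ≡⟨ length-++ (replicate b 1) ⟩
  length (replicate b 1) + length (replicate c 2 ++ (replicate d 3 ++ replicate e 4))
    ≡⟨ cong₂ _+_ (length-replicate b) (length-++ (replicate c 2)) ⟩
  b + (length (replicate c 2) + length (replicate d 3 ++ replicate e 4))
    ≡⟨ cong (λ t → b + (length (replicate c 2) + t)) (length-++ (replicate d 3)) ⟩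
  b + (length (replicate c 2) + (length (replicate d 3) + length (replicate e 4)))
    ≡⟨ cong₂ (λ s t → b + (s + t)) (length-replicate c) (cong₂ _+_ (length-replicate d) (length-replicate e)) ⟩
  b + (c + (d + e)) ∎
  where open ≡-Reasoning

canonical-unit : ∀ {x} → Index x → ∀ c → canonical (unit x ⊕ c) ↭ x ∷ canonical c
canonical-unit {0} _ (mkCounts a b c d e) = ↭-refl
canonical-unit {1} _ (mkCounts a b c d e) = shift 1 (zeros a) _
canonical-unit {2} _ (mkCounts a b c d e) =
  ↭-trans (++⁺ˡ (zeros a) (shift 2 (replicate b 1) _)) (shift 2 (zeros a) _)
canonical-unit {3} _ (mkCounts a b c d e) =
  ↭-trans (++⁺ˡ (zeros a) (++⁺ˡ (replicate b 1) (shift 3 (replicate c 2) _)))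
  (↭-trans (++⁺ˡ (zeros a) (shift 3 (replicate b 1) _)) (shift 3 (zeros a) _))
canonical-unit {4} _ (mkCounts a b c d e) =
  ↭-trans (++⁺ˡ (zeros a) (++⁺ˡ (replicate b 1) (++⁺ˡ (replicate c 2) (shift 4 (replicate d 3) _))))
  (↭-trans (++⁺ˡ (zeros a) (++⁺ˡ (replicate b 1) (shift 4 (replicate c 2) _)))
  (↭-trans (++⁺ˡ (zeros a) (shift 4 (replicate b 1) _)) (shift 4 (zeros a) _)))
canonical-unit {suc (suc (suc (suc (suc _))))} (s≤s (s≤s (s≤s (s≤s ())))) _

↭-canonical : ∀ {l} → All Index l → l ↭ canonical (tally l)
↭-canonical {[]}    []        = ↭-refl
↭-canonical {x ∷ l} (ix ∷ il) = ↭-trans (prep x (↭-canonical il)) (↭-sym (canonical-unit ix (tally l)))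

extract : ∀ {r} → Index r → ∀ t u v → unit r ⊕ t ≡ u ⊕ v →
  (unit r ≼ u × t ≡ (u ⊖ unit r) ⊕ v) ⊎ (unit r ≼ v × t ≡ u ⊕ (v ⊖ unit r))
extract {r} ir t u v eq with multiplicity r u in r∈u
... | suc _ = inj₁ (r≼u , ⊕-cancelˡ (unit r) t _ (begin
  unit r ⊕ t                  ≡⟨ eq ⟩
  u ⊕ v                       ≡⟨ cong (_⊕ v) (⊕-⊖ (unit r) u r≼u) ⟨
  unit r ⊕ (u ⊖ unit r) ⊕ v   ≡⟨ ⊕-assoc (unit r) _ v ⟩
  unit r ⊕ ((u ⊖ unit r) ⊕ v) ∎))
  where
  open ≡-Reasoning
  r≼u : unit r ≼ u
  r≼u = unit-≼ ir u (subst (1 ≤_) (sym r∈u) (s≤s z≤n))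
... | zero = inj₂ (r≼v , ⊕-cancelˡ (unit r) t _ (begin
  unit r ⊕ t                  ≡⟨ eq ⟩
  u ⊕ v                       ≡⟨ cong (u ⊕_) (⊕-⊖ (unit r) v r≼v) ⟨
  u ⊕ (unit r ⊕ (v ⊖ unit r)) ≡⟨ ⊕-assoc u (unit r) _ ⟨
  u ⊕ unit r ⊕ (v ⊖ unit r)   ≡⟨ cong (_⊕ (v ⊖ unit r)) (⊕-comm u (unit r)) ⟩
  unit r ⊕ u ⊕ (v ⊖ unit r)   ≡⟨ ⊕-assoc (unit r) u _ ⟩
  unit r ⊕ (u ⊕ (v ⊖ unit r)) ∎))
  where
  open ≡-Reasoning
  r∈v : multiplicity r v ≡ suc (multiplicity r t)
  r∈v = begin
    multiplicity r v                        ≡⟨ cong (_+ multiplicity r v) r∈u ⟨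
    multiplicity r u + multiplicity r v     ≡⟨ multiplicity-⊕ r u v ⟨
    multiplicity r (u ⊕ v)                  ≡⟨ cong (multiplicity r) eq ⟨
    multiplicity r (unit r ⊕ t)             ≡⟨ multiplicity-⊕ r (unit r) t ⟩
    multiplicity r (unit r) + multiplicity r t ≡⟨ cong (_+ multiplicity r t) (multiplicity-unit ir) ⟩
    suc (multiplicity r t)                  ∎
  r≼v : unit r ≼ v
  r≼v = unit-≼ ir v (subst (1 ≤_) (sym r∈v) (s≤s z≤n))

module _ {A : Set} (f : A → ℕ) (bounded : ∀ a → Index (f a)) where

  tallyOf : List A → Counts
  tallyOf xs = tally (map f xs)

  size-tallyOf : ∀ xs → size (tallyOf xs) ≡ length xs
  size-tallyOf xs = trans (size-tally (All.map⁺ (All.universal bounded xs))) (length-map f xs)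

  realize : ∀ xs u v → tallyOf xs ≡ u ⊕ v →
    Σ (List A) λ ys → Σ (List A) λ zs → xs ↭ ys ++ zs × tallyOf ys ≡ u × tallyOf zs ≡ v
  realize [] u v eq with ⊕≡∅ u v (sym eq)
  ... | refl , refl = [] , [] , ↭-refl , refl , refl
  realize (x ∷ xs) u v eq with extract (bounded x) (tallyOf xs) u v eq
  ... | inj₁ (x≼u , eq′) =
    let ys , zs , p , eu , ev = realize xs _ v eq′
    in x ∷ ys , zs , prep x p , trans (cong (unit (f x) ⊕_) eu) (⊕-⊖ _ u x≼u) , ev
  ... | inj₂ (x≼v , eq′) =
    let ys , zs , p , eu , ev = realize xs u _ eq′
    in ys , x ∷ zs , ↭-trans (prep x p) (↭-sym (shift x ys zs)) , eu , trans (cong (unit (f x) ⊕_) ev) (⊕-⊖ _ v x≼v)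

  realizeAll : ∀ xs vs → tallyOf xs ≡ sumCounts vs →
    Σ (List (List A)) λ Bs → map tallyOf Bs ≡ vs × xs ↭ concat Bs
  realizeAll []      []       _  = [] , refl , ↭-refl
  realizeAll (x ∷ xs) []      eq with () ← trans (sym (size-tallyOf (x ∷ xs))) (cong size eq)
  realizeAll xs      (v ∷ vs) eq =
    let ys , zs , p , eys , ezs = realize xs v (sumCounts vs) eq
        Bs , eBs , q = realizeAll zs vs ezs
    in ys ∷ Bs , cong₂ _∷_ eys eBs , ↭-trans p (++⁺ˡ ys q)

Block : ℕ → Counts → Set
Block w v = 1 ≤ size v × weight v % 5 ≡ w

-- c splits if it is the sum of at least two blocks of a common weight class.
-- (For the multiset of class indices of x this is exactly a proper τ₁₁-factorization.)
Split : Counts → Set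
Split c = Σ ℕ λ w → Σ (List Counts) λ vs → 2 ≤ length vs × All (Block w) vs × sumCounts vs ≡ c

anySub : (Counts → Bool) → Counts → Bool
anySub f (mkCounts a b c d e) =
  anyBelow (suc a) λ x → anyBelow (suc b) λ y → anyBelow (suc c) λ z →
  anyBelow (suc d) λ u → anyBelow (suc e) λ v → f (mkCounts x y z u v)

anySub-sound : ∀ f c → T (anySub f c) → Σ Counts λ v → v ≼ c × T (f v)
anySub-sound f (mkCounts a b c d e) h
  with anyBelow-sound (suc a) _ h
... | x , x≤ , h₁ with anyBelow-sound (suc b) _ h₁
... | y , y≤ , h₂ with anyBelow-sound (suc c) _ h₂
... | z , z≤ , h₃ with anyBelow-sound (suc d) _ h₃
... | u , u≤ , h₄ with anyBelow-sound (suc e) _ h₄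
... | v , v≤ , h₅ = mkCounts x y z u v , (s≤s⁻¹ x≤ , s≤s⁻¹ y≤ , s≤s⁻¹ z≤ , s≤s⁻¹ u≤ , s≤s⁻¹ v≤) , h₅

anySub-complete : ∀ f v c → v ≼ c → T (f v) → T (anySub f c)
anySub-complete f (mkCounts x y z u v) (mkCounts a b c d e) (p₁ , p₂ , p₃ , p₄ , p₅) h =
  anyBelow-complete (suc a) _ x (s≤s p₁)
   (anyBelow-complete (suc b) _ y (s≤s p₂)
    (anyBelow-complete (suc c) _ z (s≤s p₃)
     (anyBelow-complete (suc d) _ u (s≤s p₄)
      (anyBelow-complete (suc e) _ v (s≤s p₅) h))))

-- Can c be written as a sum of blocks of weight class w?  (fuel bounds the number of blocks)
partitionable : ℕ → Counts → ℕ → Bool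
partitionable zero       c w = size c ≡ᵇ 0
partitionable (suc fuel) c w = (size c ≡ᵇ 0) ∨
  anySub (λ v → (1 ≤ᵇ size v) ∧ ((weight v % 5 ≡ᵇ w) ∧ partitionable fuel (c ⊖ v) w)) c

partitionable-sound : ∀ fuel c w → T (partitionable fuel c w) →
  Σ (List Counts) λ vs → All (Block w) vs × sumCounts vs ≡ c
partitionable-sound zero c w h = [] , [] , sym (size≡0⇒∅ c (≡ᵇ⇒≡ (size c) 0 h))
partitionable-sound (suc fuel) c w h with to (T-∨ {size c ≡ᵇ 0}) h
... | inj₁ empty = [] , [] , sym (size≡0⇒∅ c (≡ᵇ⇒≡ (size c) 0 empty))
... | inj₂ h₁ with anySub-sound _ c h₁
... | v , v≼c , hv with to (T-∧ {1 ≤ᵇ size v}) hv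
... | nonempty , hv′ with to (T-∧ {weight v % 5 ≡ᵇ w}) hv′
... | wv , rest with partitionable-sound fuel (c ⊖ v) w rest
... | vs , blocks , sum≡ =
  v ∷ vs , (≤ᵇ⇒≤ 1 (size v) nonempty , ≡ᵇ⇒≡ _ _ wv) ∷ blocks ,
  trans (cong (v ⊕_) sum≡) (⊕-⊖ v c v≼c)

size-blocks : ∀ {w} vs → All (Block w) vs → length vs ≤ size (sumCounts vs)
size-blocks []       []                = z≤n
size-blocks (v ∷ vs) ((s₁ , _) ∷ bvs) =
  ≤-trans (+-mono-≤ s₁ (size-blocks vs bvs)) (≤-reflexive (sym (size-⊕ v (sumCounts vs))))

partitionable-complete : ∀ fuel vs w → All (Block w) vs → size (sumCounts vs) ≤ fuel →
  T (partitionable fuel (sumCounts vs) w)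
partitionable-complete zero       []       w []  _ = _
partitionable-complete (suc fuel) []       w []  _ = _
partitionable-complete zero       (v ∷ vs) w bvs@(_ ∷ _) le with () ← ≤-trans (size-blocks (v ∷ vs) bvs) le
partitionable-complete (suc fuel) (v ∷ vs) w ((s₁ , wv) ∷ bvs) le =
  from (T-∨ {size (sumCounts (v ∷ vs)) ≡ᵇ 0}) (inj₂
    (anySub-complete _ v (sumCounts (v ∷ vs)) (≼-⊕ v (sumCounts vs))
      (from T-∧ (≤⇒≤ᵇ s₁ , from T-∧ (≡⇒≡ᵇ _ _ wv ,
        subst (λ r → T (partitionable fuel r w)) (sym (⊕⊖-cancel v (sumCounts vs)))
          (partitionable-complete fuel vs w bvs le′))))))
  where
  le′ : size (sumCounts vs) ≤ fuel
  le′ = s≤s⁻¹ (≤-trans (+-monoˡ-≤ (size (sumCounts vs)) s₁)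
                (≤-trans (≤-reflexive (sym (size-⊕ v (sumCounts vs)))) le))

firstBlock : Counts → ℕ → Counts → Bool
firstBlock c w v = (1 ≤ᵇ size v) ∧ ((1 ≤ᵇ size (c ⊖ v)) ∧
  ((weight v % 5 ≡ᵇ w) ∧ partitionable (size c) (c ⊖ v) w))

splittable : Counts → Bool
splittable c = anyBelow 5 λ w → anySub (firstBlock c w) c

splittable-sound : ∀ c → T (splittable c) → Split c
splittable-sound c h with anyBelow-sound 5 _ h
... | w , _ , h₁ with anySub-sound (firstBlock c w) c h₁
... | v , v≼c , hv with to (T-∧ {1 ≤ᵇ size v}) hv
... | nonempty , hv₁ with to (T-∧ {1 ≤ᵇ size (c ⊖ v)}) hv₁
... | restNonempty , hv₂ with to (T-∧ {weight v % 5 ≡ᵇ w}) hv₂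
... | wv , hrest with partitionable-sound (size c) (c ⊖ v) w hrest
... | [] , _ , ∅≡rest with () ← subst (λ r → 1 ≤ size r) (sym ∅≡rest) (≤ᵇ⇒≤ 1 _ restNonempty)
... | u ∷ us , blocks , sum≡ =
  w , v ∷ u ∷ us , s≤s (s≤s z≤n) , (≤ᵇ⇒≤ 1 (size v) nonempty , ≡ᵇ⇒≡ _ _ wv) ∷ blocks ,
  trans (cong (v ⊕_) sum≡) (⊕-⊖ v c v≼c)

splittable-complete : ∀ c → Split c → T (splittable c)
splittable-complete c (_ , _ ∷ [] , s≤s () , _)
splittable-complete c (w , v ∷ u ∷ us , _ , (s₁ , wv) ∷ bus , refl) =
  anyBelow-complete 5 (λ w → anySub (firstBlock c w) c) w w<5
   (anySub-complete (firstBlock c w) v c (≼-⊕ v rest)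
    (from T-∧ (≤⇒≤ᵇ s₁ , from T-∧ (≤⇒≤ᵇ restNonempty , from T-∧ (≡⇒≡ᵇ _ _ wv ,
      subst (λ r → T (partitionable (size c) r w)) (sym (⊕⊖-cancel v rest))
        (partitionable-complete (size c) (u ∷ us) w bus rest≤c))))))
  where
  rest = sumCounts (u ∷ us)
  w<5 : w < 5
  w<5 = subst (_< 5) wv (m%n<n (weight v) 5)
  rest≤c : size rest ≤ size c
  rest≤c = ≤-trans (m≤n+m (size rest) (size v)) (≤-reflexive (sym (size-⊕ v rest)))
  restNonempty : 1 ≤ size (c ⊖ v)
  restNonempty = subst (λ r → 1 ≤ size r) (sym (⊕⊖-cancel v rest))
    (≤-trans (s≤s z≤n) (size-blocks (u ∷ us) bus))

Split-addZeros : ∀ c n → Split c → Split (c ⊕ mkCounts n 0 0 0 0)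
Split-addZeros c n (w , v ∷ vs , len , (s₁ , wv) ∷ bvs , refl) =
  w , (v ⊕ z) ∷ vs , len , (nonempty , weight≡) ∷ bvs , sum≡
  where
  z = mkCounts n 0 0 0 0
  nonempty : 1 ≤ size (v ⊕ z)
  nonempty = ≤-trans s₁ (≤-trans (m≤m+n (size v) (size z)) (≤-reflexive (sym (size-⊕ v z))))
  weight≡ : weight (v ⊕ z) % 5 ≡ w
  weight≡ = trans (cong (_% 5) (trans (weight-⊕ v z) (+-identityʳ (weight v)))) wv
  sum≡ : v ⊕ z ⊕ sumCounts vs ≡ v ⊕ sumCounts vs ⊕ z
  sum≡ = begin
    v ⊕ z ⊕ sumCounts vs   ≡⟨ ⊕-assoc v z _ ⟩
    v ⊕ (z ⊕ sumCounts vs) ≡⟨ cong (v ⊕_) (⊕-comm z _) ⟩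
    v ⊕ (sumCounts vs ⊕ z) ≡⟨ ⊕-assoc v _ z ⟨
    v ⊕ sumCounts vs ⊕ z   ∎
    where open ≡-Reasoning

zerosOnlyBlock : ∀ {w} v → Block w v → nonzeroSize v ≡ 0 → dropZeros v ≡ ∅ × w ≡ 0 × 1 ≤ zeroCount v
zerosOnlyBlock {w} v (nonempty , wv) noNonzeros = v′≡∅ , w≡0 , zeros≥1
  where
  v′≡∅ : dropZeros v ≡ ∅
  v′≡∅ = size≡0⇒∅ (dropZeros v) (trans (size-dropZeros v) noNonzeros)
  w≡0 : w ≡ 0
  w≡0 = trans (sym wv) (trans (cong (_% 5) (sym (weight-dropZeros v))) (cong (λ r → weight r % 5) v′≡∅))
  zeros≥1 : 1 ≤ zeroCount v
  zeros≥1 = subst (1 ≤_) (trans (size≡zeros+nonzeros v) (trans (cong (_+_ (zeroCount v)) noNonzeros) (+-identityʳ _)))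
              nonempty

dropZeros-blocks : ∀ w vs → All (Block w) vs →
  Σ (List Counts) λ us → All (Block w) us × sumCounts us ≡ dropZeros (sumCounts vs) ×
    (length us ≡ length vs ⊎ (w ≡ 0 × 1 ≤ zeroCount (sumCounts vs)))
dropZeros-blocks w [] [] = [] , [] , refl , inj₁ refl
dropZeros-blocks w (v ∷ vs) (bv@(_ , wv) ∷ bvs) with dropZeros-blocks w vs bvs | nonzeroSize v in nz
... | us , bus , sum≡ , _ | zero with zerosOnlyBlock v bv nz
...   | v′≡∅ , w≡0 , zeros≥1 = us , bus , sum≡′ , inj₂ (w≡0 , zeros≥1′)
  where
  open ≡-Reasoning
  sum≡′ : sumCounts us ≡ dropZeros (v ⊕ sumCounts vs)
  sum≡′ = begin
    sumCounts us                           ≡⟨ sum≡ ⟩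
    dropZeros (sumCounts vs)               ≡⟨ ⊕-identityˡ _ ⟨
    ∅ ⊕ dropZeros (sumCounts vs)           ≡⟨ cong (_⊕ dropZeros (sumCounts vs)) v′≡∅ ⟨
    dropZeros v ⊕ dropZeros (sumCounts vs) ≡⟨ dropZeros-⊕ v (sumCounts vs) ⟨
    dropZeros (v ⊕ sumCounts vs)           ∎
  zeros≥1′ : 1 ≤ zeroCount (v ⊕ sumCounts vs)
  zeros≥1′ = subst (1 ≤_) (sym (zeroCount-⊕ v (sumCounts vs))) (≤-trans zeros≥1 (m≤m+n (zeroCount v) _))
dropZeros-blocks w (v ∷ vs) ((_ , wv) ∷ bvs) | us , bus , sum≡ , len | suc _ =
  dropZeros v ∷ us , (nonempty , weight≡) ∷ bus ,
  trans (cong (dropZeros v ⊕_) sum≡) (sym (dropZeros-⊕ v (sumCounts vs))) , extend len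
  where
  nonempty : 1 ≤ size (dropZeros v)
  nonempty = subst (1 ≤_) (sym (trans (size-dropZeros v) nz)) (s≤s z≤n)
  weight≡ : weight (dropZeros v) % 5 ≡ w
  weight≡ = trans (cong (_% 5) (weight-dropZeros v)) wv
  extend : length us ≡ length vs ⊎ (w ≡ 0 × 1 ≤ zeroCount (sumCounts vs)) →
    suc (length us) ≡ suc (length vs) ⊎ (w ≡ 0 × 1 ≤ zeroCount (v ⊕ sumCounts vs))
  extend (inj₁ eq)          = inj₁ (cong suc eq)
  extend (inj₂ (w≡0 , z≥1)) = inj₂ (w≡0 , subst (1 ≤_) (sym (zeroCount-⊕ v (sumCounts vs)))
                                              (≤-trans z≥1 (m≤n+m _ (zeroCount v))))

weight-blocks₀ : ∀ vs → All (Block 0) vs → weight (sumCounts vs) % 5 ≡ 0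
weight-blocks₀ []       []              = refl
weight-blocks₀ (v ∷ vs) ((_ , wv) ∷ bvs) = begin
  weight (v ⊕ sumCounts vs) % 5                    ≡⟨ cong (_% 5) (weight-⊕ v (sumCounts vs)) ⟩
  (weight v + weight (sumCounts vs)) % 5           ≡⟨ %-distribˡ-+ (weight v) _ 5 ⟩
  (weight v % 5 + weight (sumCounts vs) % 5) % 5   ≡⟨ cong₂ (λ a b → (a + b) % 5) wv (weight-blocks₀ vs bvs) ⟩
  0                                                ∎
  where open ≡-Reasoning

-- Removing all zeros from a split multiset leaves it split, unless some block consisted of
-- zeros only; then the common weight class is 0, so the total weight is ≡ 0 (mod 5).
Split-dropZeros : ∀ c → Split c → Split (dropZeros c) ⊎ (weight c % 5 ≡ 0 × 1 ≤ zeroCount c)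
Split-dropZeros c (w , vs , 2≤len , bvs , refl) with dropZeros-blocks w vs bvs
... | us , bus , sum≡ , inj₁ len≡ = inj₁ (w , us , subst (2 ≤_) (sym len≡) 2≤len , bus , sum≡)
... | _  , _   , _    , inj₂ (refl , zeros≥1) = inj₂ (weight-blocks₀ vs bvs , zeros≥1)

infix 4 _≢ᵇ_ _≡₅ᵇ_

_≢ᵇ_ : ℕ → ℕ → Bool
i ≢ᵇ j = not (i ≡ᵇ j)

_≡₅ᵇ_ : ℕ → ℕ → Bool
x ≡₅ᵇ y = x % 5 ≡ᵇ y % 5

≢⇒≢ᵇ : ∀ {i j} → i ≢ j → T (i ≢ᵇ j)
≢⇒≢ᵇ {i} {j} i≢j = ¬T⇒T-not (λ h → i≢j (≡ᵇ⇒≡ i j h))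

≢ᵇ⇒≢ : ∀ {i j} → T (i ≢ᵇ j) → i ≢ j
≢ᵇ⇒≢ {i} h refl = T-not (≡⇒≡ᵇ i i refl) h

≢₅⇒≢₅ᵇ : ∀ x y → ¬ (x ≡₅ y) → T (not (x ≡₅ᵇ y))
≢₅⇒≢₅ᵇ x y h = ¬T⇒T-not (λ e → h (≡ᵇ⇒≡ (x % 5) (y % 5) e))

≢₅ᵇ⇒≢₅ : ∀ x y → T (not (x ≡₅ᵇ y)) → ¬ (x ≡₅ y)
≢₅ᵇ⇒≢₅ x y h e = T-not (≡⇒≡ᵇ (x % 5) (y % 5) e) h

-- The forms (d)/(e) for {0ᵏ, i, i, j}; hz says whether k > 0.
tripleForm : Bool → ℕ → ℕ → Bool
tripleForm hz i j = (i ≢ᵇ j) ∧ (not (2 * i ≡₅ᵇ j) ∧ (not hz ∨ not (2 * i + j ≡₅ᵇ 0)))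

-- Triples and quadruples are accepted in both orders in which a sorted list
-- can present them.
shapeBool : Bool → List ℕ → Bool
shapeBool hz (i ∷ [])             = true
shapeBool hz (i ∷ j ∷ [])         = (i ≢ᵇ j) ∧ (not hz ∨ not (i + j ≡₅ᵇ 0))
shapeBool hz (x ∷ y ∷ z ∷ [])     = ((x ≡ᵇ y) ∧ tripleForm hz x z) ∨ ((y ≡ᵇ z) ∧ tripleForm hz y x)
shapeBool hz (x ∷ y ∷ z ∷ u ∷ []) = not hz ∧
  (((x ≡ᵇ y) ∧ ((y ≡ᵇ z) ∧ (u ≡₅ᵇ 2 * x))) ∨ ((y ≡ᵇ z) ∧ ((z ≡ᵇ u) ∧ (x ≡₅ᵇ 2 * y))))
shapeBool hz _                    = false

hasShape : Counts → Bool
hasShape c = shapeBool (0 <ᵇ zeroCount c) (nonzeroList c)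

shapeBool-length : ∀ hz l → T (shapeBool hz l) → length l ≤ 4
shapeBool-length hz (_ ∷ [])             _ = s≤s z≤n
shapeBool-length hz (_ ∷ _ ∷ [])         _ = s≤s (s≤s z≤n)
shapeBool-length hz (_ ∷ _ ∷ _ ∷ [])     _ = s≤s (s≤s (s≤s z≤n))
shapeBool-length hz (_ ∷ _ ∷ _ ∷ _ ∷ []) _ = s≤s (s≤s (s≤s (s≤s z≤n)))

no-zeros : ∀ k → T (not (0 <ᵇ k)) → k ≡ 0
no-zeros zero _ = refl

triple-sound : ∀ k i j → NonzeroIdx i → NonzeroIdx j → T (tripleForm (0 <ᵇ k) i j) →
  Σ (List ℕ) λ ms → Shape ms × zeros k ++ i ∷ i ∷ j ∷ [] ↭ ms
triple-sound k i j ni nj h with to (T-∧ {i ≢ᵇ j}) h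
... | i≢j , h₁ with to (T-∧ {not (2 * i ≡₅ᵇ j)}) h₁
... | 2i≢j , h₂ with to (T-∨ {not (0 <ᵇ k)}) h₂
... | inj₂ 2i+j≢0 =
  _ , form-e k i j ni nj (≢ᵇ⇒≢ i≢j) (≢₅ᵇ⇒≢₅ (2 * i) j 2i≢j) (≢₅ᵇ⇒≢₅ (2 * i + j) 0 2i+j≢0) , ↭-refl
... | inj₁ k≯0 with no-zeros k k≯0
... | refl = _ , form-d i j ni nj (≢ᵇ⇒≢ i≢j) (≢₅ᵇ⇒≢₅ (2 * i) j 2i≢j) , ↭-refl

shape-sound : ∀ k l → All NonzeroIdx l → T (shapeBool (0 <ᵇ k) l) →
  Σ (List ℕ) λ ms → Shape ms × zeros k ++ l ↭ ms
shape-sound k (i ∷ []) (ni ∷ []) _ = _ , form-a k i ni , ↭-refl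
shape-sound k (i ∷ j ∷ []) (ni ∷ nj ∷ []) h with to (T-∧ {i ≢ᵇ j}) h
... | i≢j , h₁ with to (T-∨ {not (0 <ᵇ k)}) h₁
... | inj₂ i+j≢0 = _ , form-c k i j ni nj (≢ᵇ⇒≢ i≢j) (≢₅ᵇ⇒≢₅ (i + j) 0 i+j≢0) , ↭-refl
... | inj₁ k≯0 with no-zeros k k≯0
... | refl = _ , form-b i j ni nj (≢ᵇ⇒≢ i≢j) , ↭-refl
shape-sound k (x ∷ y ∷ z ∷ []) (nx ∷ ny ∷ nz ∷ []) h with to (T-∨ {(x ≡ᵇ y) ∧ tripleForm (0 <ᵇ k) x z}) h
... | inj₁ h₁ with to (T-∧ {x ≡ᵇ y}) h₁
...   | x≡y , t with ≡ᵇ⇒≡ x y x≡y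
...     | refl = triple-sound k x z nx nz t
shape-sound k (x ∷ y ∷ z ∷ []) (nx ∷ ny ∷ nz ∷ []) h | inj₂ h₁ with to (T-∧ {y ≡ᵇ z}) h₁
...   | y≡z , t with ≡ᵇ⇒≡ y z y≡z
...     | refl = let ms , sh , p = triple-sound k y x ny nx t
                 in ms , sh , ↭-trans (++⁺ˡ (zeros k) (↭-trans (swap x y ↭-refl) (prep y (swap x y ↭-refl)))) p
shape-sound k (x ∷ y ∷ z ∷ u ∷ []) (nx ∷ ny ∷ nz ∷ nu ∷ []) h with to (T-∧ {not (0 <ᵇ k)}) h
... | k≯0 , h₁ with no-zeros k k≯0 | to (T-∨ {(x ≡ᵇ y) ∧ ((y ≡ᵇ z) ∧ (u ≡₅ᵇ 2 * x))}) h₁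
... | refl | inj₁ h₂ with to (T-∧ {x ≡ᵇ y}) h₂
...   | x≡y , h₃ with to (T-∧ {y ≡ᵇ z}) h₃
...     | y≡z , u≡2x with ≡ᵇ⇒≡ x y x≡y | ≡ᵇ⇒≡ y z y≡z
...       | refl | refl = _ , form-f x u nx nu (≡ᵇ⇒≡ _ _ u≡2x) , ↭-refl
shape-sound k (x ∷ y ∷ z ∷ u ∷ []) (nx ∷ ny ∷ nz ∷ nu ∷ []) h | _ , _ | refl | inj₂ h₂ with to (T-∧ {y ≡ᵇ z}) h₂
...   | y≡z , h₃ with to (T-∧ {z ≡ᵇ u}) h₃
...     | z≡u , x≡2y with ≡ᵇ⇒≡ y z y≡z | ≡ᵇ⇒≡ z u z≡u
...       | refl | refl = _ , form-f y x ny nx (≡ᵇ⇒≡ _ _ x≡2y) ,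
  ↭-trans (swap x y ↭-refl) (prep y (↭-trans (swap x y ↭-refl) (prep y (swap x y ↭-refl))))

hasShape-sound : ∀ c → T (hasShape c) → Σ (List ℕ) λ ms → Shape ms × canonical c ↭ ms
hasShape-sound c = shape-sound (zeroCount c) (nonzeroList c) (nonzeroList-nonzero c)

allLists : ℕ → (List ℕ → Bool) → Bool
allLists zero    f = f []
allLists (suc n) f = allBelow 4 λ i → allLists n (λ l → f (suc i ∷ l))

allLists-sound : ∀ n f → T (allLists n f) → ∀ l → All NonzeroIdx l → length l ≡ n → T (f l)
allLists-sound zero    f h []      []                         refl = h
allLists-sound (suc n) f h (suc i ∷ l) ((_ , i<4) ∷ nl) eq =
  allLists-sound n (λ l → f (suc i ∷ l)) (allBelow-sound 4 (λ i → allLists n (λ l → f (suc i ∷ l))) h i i<4) l nl (suc-injective eq)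

-- Finite check: for lists of at most four nonzero indices, shapeBool does not depend on the
-- order of the list (it is only ever evaluated on sorted lists).
sortingCheck : Bool → Bool
sortingCheck hz = allBelow 5 λ n → allLists n λ l → shapeBool hz l ⇒ᵇ shapeBool hz (nonzeroList (tally l))

sortingCheck-holds : ∀ hz → T (sortingCheck hz)
sortingCheck-holds false = _
sortingCheck-holds true  = _

shapeBool-sort : ∀ hz l → All NonzeroIdx l → T (shapeBool hz l) → T (shapeBool hz (nonzeroList (tally l)))
shapeBool-sort hz l nl h = ⇒ᵇ-elim (allLists-sound (length l) sortable lengthOk l nl refl) h
  where
  sortable : List ℕ → Bool
  sortable l = shapeBool hz l ⇒ᵇ shapeBool hz (nonzeroList (tally l))
  lengthOk : T (allLists (length l) sortable)
  lengthOk = allBelow-sound 5 (λ n → allLists n sortable) (sortingCheck-holds hz) (length l)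
               (s≤s (shapeBool-length hz l h))

zeroCount-tally : ∀ {l} → All NonzeroIdx l → zeroCount (tally l) ≡ 0
zeroCount-tally {[]}    []        = refl
zeroCount-tally {x ∷ l} (nx ∷ nl) = trans (zeroCount-⊕ (unit x) (tally l)) (cong₂ _+_ (unit-nonzero nx) (zeroCount-tally nl))
  where
  unit-nonzero : ∀ {x} → NonzeroIdx x → zeroCount (unit x) ≡ 0
  unit-nonzero {1} _ = refl
  unit-nonzero {2} _ = refl
  unit-nonzero {3} _ = refl
  unit-nonzero {4} _ = refl
  unit-nonzero {suc (suc (suc (suc (suc _))))} (_ , s≤s (s≤s (s≤s (s≤s ()))))

hasShape-zeros : ∀ k l → All NonzeroIdx l → hasShape (tally (zeros k ++ l)) ≡ shapeBool (0 <ᵇ k) (nonzeroList (tally l))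
hasShape-zeros k l nl rewrite tally-zeros k l = addZeros (tally l) (zeroCount-tally nl)
  where
  addZeros : ∀ t → zeroCount t ≡ 0 → hasShape (mkCounts k 0 0 0 0 ⊕ t) ≡ shapeBool (0 <ᵇ k) (nonzeroList t)
  addZeros (mkCounts .0 _ _ _ _) refl rewrite +-identityʳ k = refl

fromForm : ∀ k l → All NonzeroIdx l → T (shapeBool (0 <ᵇ k) l) → T (hasShape (tally (zeros k ++ l)))
fromForm k l nl h = subst T (sym (hasShape-zeros k l nl)) (shapeBool-sort _ l nl h)

hasShape-complete : ∀ {ms} → Shape ms → T (hasShape (tally ms))
hasShape-complete (form-a k i ni) = fromForm k (i ∷ []) (ni ∷ []) _
hasShape-complete (form-b i j ni nj i≢j) =
  fromForm 0 (i ∷ j ∷ []) (ni ∷ nj ∷ []) (from T-∧ (≢⇒≢ᵇ i≢j , _))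
hasShape-complete (form-c k i j ni nj i≢j i+j≢0) =
  fromForm k (i ∷ j ∷ []) (ni ∷ nj ∷ []) (from T-∧ (≢⇒≢ᵇ i≢j , from (T-∨ {not (0 <ᵇ k)}) (inj₂ (≢₅⇒≢₅ᵇ (i + j) 0 i+j≢0))))
hasShape-complete (form-d i j ni nj i≢j 2i≢j) =
  fromForm 0 (i ∷ i ∷ j ∷ []) (ni ∷ ni ∷ nj ∷ [])
    (from T-∨ (inj₁ (from T-∧ (≡⇒≡ᵇ i i refl , from T-∧ (≢⇒≢ᵇ i≢j , from T-∧ (≢₅⇒≢₅ᵇ (2 * i) j 2i≢j , _))))))
hasShape-complete (form-e k i j ni nj i≢j 2i≢j 2i+j≢0) =
  fromForm k (i ∷ i ∷ j ∷ []) (ni ∷ ni ∷ nj ∷ [])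
    (from T-∨ (inj₁ (from T-∧ (≡⇒≡ᵇ i i refl , from T-∧ (≢⇒≢ᵇ i≢j , from T-∧ (≢₅⇒≢₅ᵇ (2 * i) j 2i≢j ,
      from (T-∨ {not (0 <ᵇ k)}) (inj₂ (≢₅⇒≢₅ᵇ (2 * i + j) 0 2i+j≢0))))))))
hasShape-complete (form-f i r ni nr r≡2i) =
  fromForm 0 (i ∷ i ∷ i ∷ r ∷ []) (ni ∷ ni ∷ ni ∷ nr ∷ [])
    (from T-∧ (_ , from T-∨ (inj₁ (from T-∧ (≡⇒≡ᵇ i i refl , from T-∧ (≡⇒≡ᵇ i i refl , ≡⇒≡ᵇ _ _ r≡2i))))))

allBelow⁴ : ℕ → (ℕ → ℕ → ℕ → ℕ → Bool) → Bool
allBelow⁴ n f = allBelow n λ a → allBelow n λ b → allBelow n λ c → allBelow n λ d → f a b c d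

allBelow⁴-sound : ∀ n f → T (allBelow⁴ n f) → ∀ a b c d → a < n → b < n → c < n → d < n → T (f a b c d)
allBelow⁴-sound n f h a b c d a<n b<n c<n d<n =
  allBelow-sound n (f a b c) (allBelow-sound n (λ c → allBelow n (f a b c))
    (allBelow-sound n (λ b → allBelow n λ c → allBelow n (f a b c))
      (allBelow-sound n (λ a → allBelow n λ b → allBelow n λ c → allBelow n (f a b c)) h a a<n)
    b b<n) c c<n) d d<n

nonzero-bounds : ∀ z a b c d {n} → nonzeroSize (mkCounts z a b c d) ≤ n → a ≤ n × b ≤ n × c ≤ n × d ≤ n
nonzero-bounds z a b c d h =
  ≤-trans (m≤m+n a _) h ,
  ≤-trans (≤-trans (m≤m+n b _) (m≤n+m _ a)) h ,
  ≤-trans (≤-trans (≤-trans (m≤m+n c d) (m≤n+m _ b)) (m≤n+m _ a)) h ,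
  ≤-trans (≤-trans (≤-trans (m≤n+m d c) (m≤n+m _ b)) (m≤n+m _ a)) h

unsplittableCheck : ℕ → ℕ → ℕ → ℕ → Bool
unsplittableCheck a b c d = let v = mkCounts 0 a b c d in
  (shapeBool false (nonzeroList v) ⇒ᵇ not (splittable v)) ∧
  (shapeBool true (nonzeroList v) ⇒ᵇ (not (splittable v) ∧ not (weight v ≡₅ᵇ 0)))

unsplittableCheck-holds : T (allBelow⁴ 5 unsplittableCheck)
unsplittableCheck-holds = _

withZeros : ∀ a b c d → T (unsplittableCheck a b c d) → let v = mkCounts 0 a b c d in
  T (shapeBool true (nonzeroList v)) → T (not (splittable v)) × T (not (weight v ≡₅ᵇ 0))
withZeros a b c d check h = to T-∧ (⇒ᵇ-elim (proj₂ (to (T-∧ {shapeBool false (nonzeroList (mkCounts 0 a b c d)) ⇒ᵇ _}) check)) h)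

-- the check applies to every multiset of one of the forms: it has at most four nonzero elements
unsplittableCheck-at : ∀ z a b c d → T (hasShape (mkCounts z a b c d)) → T (unsplittableCheck a b c d)
unsplittableCheck-at z a b c d h =
  allBelow⁴-sound 5 unsplittableCheck unsplittableCheck-holds a b c d (s≤s a≤4) (s≤s b≤4) (s≤s c≤4) (s≤s d≤4)
  where
  v = mkCounts z a b c d
  bounds = nonzero-bounds z a b c d (subst (_≤ 4) (length-nonzeroList v) (shapeBool-length _ (nonzeroList v) h))
  a≤4 = proj₁ bounds
  b≤4 = proj₁ (proj₂ bounds)
  c≤4 = proj₁ (proj₂ (proj₂ bounds))
  d≤4 = proj₂ (proj₂ (proj₂ bounds))

-- Multisets of one of the forms (a)–(f) do not split: drop the zeros and apply the check.
shape⇒unsplittable : ∀ c → T (hasShape c) → ¬ Split c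
shape⇒unsplittable c@(mkCounts zero a b cc d) h split with Split-dropZeros c split
... | inj₁ split′ = T-not (splittable-complete c split′) (⇒ᵇ-elim noZeros h)
  where noZeros = proj₁ (to (T-∧ {shapeBool false (nonzeroList c) ⇒ᵇ _}) (unsplittableCheck-at 0 a b cc d h))
... | inj₂ (_ , ())
shape⇒unsplittable c@(mkCounts (suc z) a b cc d) h split with Split-dropZeros c split
... | inj₁ split′    = T-not (splittable-complete _ split′) (proj₁ unsplittable-weight)
  where unsplittable-weight = withZeros a b cc d (unsplittableCheck-at (suc z) a b cc d h) h
... | inj₂ (w≡0 , _) = T-not (≡⇒≡ᵇ _ _ w≡0) (proj₂ unsplittable-weight)
  where unsplittable-weight = withZeros a b cc d (unsplittableCheck-at (suc z) a b cc d h) h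

smallBlock : ℕ → Counts → Bool
smallBlock t u = (1 ≤ᵇ size u) ∧ ((size u ≤ᵇ 5) ∧ (weight u % 5 ≡ᵇ t))

subsumCheck : ℕ → ℕ → ℕ → ℕ → Bool
subsumCheck a b c d = (5 ≤ᵇ nonzeroSize v) ⇒ᵇ (allBelow 5 λ t → anySub (smallBlock t) v)
  where v = mkCounts 0 a b c d

subsumCheck-holds : T (allBelow⁴ 6 subsumCheck)
subsumCheck-holds = _

⊓-subadditive : ∀ x y k → (x + y) ⊓ k ≤ x ⊓ k + y ⊓ k
⊓-subadditive x y k with ≤-total k x | ≤-total k y
... | inj₁ k≤x | _ = ≤-trans (m⊓n≤n (x + y) k) (≤-trans (≤-reflexive (sym (m≥n⇒m⊓n≡n k≤x))) (m≤m+n (x ⊓ k) (y ⊓ k)))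
... | inj₂ _ | inj₁ k≤y = ≤-trans (m⊓n≤n (x + y) k) (≤-trans (≤-reflexive (sym (m≥n⇒m⊓n≡n k≤y))) (m≤n+m (y ⊓ k) (x ⊓ k)))
... | inj₂ x≤k | inj₂ y≤k = ≤-trans (m⊓n≤m (x + y) k) (≤-reflexive (sym (cong₂ _+_ (m≤n⇒m⊓n≡m x≤k) (m≤n⇒m⊓n≡m y≤k))))

cap : Counts → Counts
cap (mkCounts _ a b c d) = mkCounts 0 (a ⊓ 5) (b ⊓ 5) (c ⊓ 5) (d ⊓ 5)

cap-≼ : ∀ c → cap c ≼ c
cap-≼ (mkCounts z a b c d) = z≤n , m⊓n≤m a 5 , m⊓n≤m b 5 , m⊓n≤m c 5 , m⊓n≤m d 5

nonzeroSize-cap : ∀ c → 5 ≤ nonzeroSize c → 5 ≤ nonzeroSize (cap c)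
nonzeroSize-cap (mkCounts z a b c d) h = begin
  5                                         ≡⟨ m≥n⇒m⊓n≡n h ⟨
  (a + (b + (c + d))) ⊓ 5                   ≤⟨ ⊓-subadditive a (b + (c + d)) 5 ⟩
  a ⊓ 5 + (b + (c + d)) ⊓ 5                 ≤⟨ +-monoʳ-≤ (a ⊓ 5) (⊓-subadditive b (c + d) 5) ⟩
  a ⊓ 5 + (b ⊓ 5 + (c + d) ⊓ 5)             ≤⟨ +-monoʳ-≤ (a ⊓ 5) (+-monoʳ-≤ (b ⊓ 5) (⊓-subadditive c d 5)) ⟩
  a ⊓ 5 + (b ⊓ 5 + (c ⊓ 5 + d ⊓ 5))         ∎
  where open ≤-Reasoning

small-subsum : ∀ c t → 5 ≤ nonzeroSize c → t < 5 →
  Σ Counts λ u → u ≼ c × 1 ≤ size u × size u ≤ 5 × weight u % 5 ≡ t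
small-subsum c@(mkCounts _ a b cc d) t 5≤c t<5 = fromSmallBlock (anySub-sound (smallBlock t) (cap c) found)
  where
  checked : T (subsumCheck (a ⊓ 5) (b ⊓ 5) (cc ⊓ 5) (d ⊓ 5))
  checked = allBelow⁴-sound 6 subsumCheck subsumCheck-holds (a ⊓ 5) (b ⊓ 5) (cc ⊓ 5) (d ⊓ 5)
              (s≤s (m⊓n≤n a 5)) (s≤s (m⊓n≤n b 5)) (s≤s (m⊓n≤n cc 5)) (s≤s (m⊓n≤n d 5))
  allWeights : T (allBelow 5 λ t → anySub (smallBlock t) (cap c))
  allWeights = ⇒ᵇ-elim {5 ≤ᵇ nonzeroSize (cap c)} {allBelow 5 λ t → anySub (smallBlock t) (cap c)}
                 checked (≤⇒≤ᵇ (nonzeroSize-cap c 5≤c))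
  found : T (anySub (smallBlock t) (cap c))
  found = allBelow-sound 5 (λ t → anySub (smallBlock t) (cap c)) allWeights t t<5
  fromSmallBlock : Σ Counts (λ u → u ≼ cap c × T (smallBlock t u)) →
    Σ Counts λ u → u ≼ c × 1 ≤ size u × size u ≤ 5 × weight u % 5 ≡ t
  fromSmallBlock (u , u≼cap , h) =
    let nonempty , h′ = to (T-∧ {1 ≤ᵇ size u}) h
        small , weight≡ = to (T-∧ {size u ≤ᵇ 5}) h′
    in u , ≼-trans u (cap c) c u≼cap (cap-≼ c) , ≤ᵇ⇒≤ 1 (size u) nonempty , ≤ᵇ⇒≤ (size u) 5 small ,
       ≡ᵇ⇒≡ (weight u % 5) t weight≡

-- Finite check on residues: if x ≡ 3(x + y) (mod 5), i.e. 2x ≡ x + y, then y ≡ x (mod 5).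
halvingCase : ℕ → ℕ → Bool
halvingCase x y = (x ≡ᵇ (3 * ((x + y) % 5)) % 5) ⇒ᵇ (y ≡ᵇ x)

halvingCheck : T (allBelow 5 λ x → allBelow 5 (halvingCase x))
halvingCheck = _

halving : ∀ x y → x % 5 ≡ (3 * (x + y)) % 5 → y % 5 ≡ x % 5
halving x y h = ≡ᵇ⇒≡ (y % 5) (x % 5) (⇒ᵇ-elim residueCase (≡⇒≡ᵇ (x % 5) _ (trans h reduce)))
  where
  reduce : (3 * (x + y)) % 5 ≡ (3 * ((x % 5 + y % 5) % 5)) % 5
  reduce = trans (%-distribˡ-* 3 (x + y) 5) (cong (λ r → (3 * r) % 5) (%-distribˡ-+ x y 5))
  residueCase : T (halvingCase (x % 5) (y % 5))
  residueCase = allBelow-sound 5 (halvingCase (x % 5))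
    (allBelow-sound 5 (λ x → allBelow 5 (halvingCase x)) halvingCheck (x % 5) (m%n<n x 5)) (y % 5) (m%n<n y 5)

-- A multiset with at least six nonzero elements splits into two blocks: a sub-multiset u of at
-- most five elements with 2·weight u ≡ weight c, and its (nonempty) complement.
manyNonzeros⇒split : ∀ c → 6 ≤ nonzeroSize c → Split c
manyNonzeros⇒split c 6≤c with small-subsum c ((3 * weight c) % 5) (≤-trans (n≤1+n 5) 6≤c) (m%n<n (3 * weight c) 5)
... | u , u≼c , nonempty , small , weight≡ =
  weight u % 5 , u ∷ c ⊖ u ∷ [] , s≤s (s≤s z≤n) , (nonempty , refl) ∷ (restNonempty , restWeight) ∷ [] ,
  trans (cong (u ⊕_) (⊕-identityʳ (c ⊖ u))) u⊕rest
  where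
  u⊕rest : u ⊕ (c ⊖ u) ≡ c
  u⊕rest = ⊕-⊖ u c u≼c
  sizes : size u + size (c ⊖ u) ≡ size c
  sizes = trans (sym (size-⊕ u (c ⊖ u))) (cong size u⊕rest)
  restNonempty : 1 ≤ size (c ⊖ u)
  restNonempty = +-cancelˡ-≤ (size u) 1 (size (c ⊖ u)) (begin
    size u + 1             ≤⟨ +-monoˡ-≤ 1 small ⟩
    6                      ≤⟨ 6≤c ⟩
    nonzeroSize c          ≤⟨ m≤n+m _ (zeroCount c) ⟩
    zeroCount c + nonzeroSize c ≡⟨ size≡zeros+nonzeros c ⟨
    size c                 ≡⟨ sizes ⟨
    size u + size (c ⊖ u)  ∎)
    where open ≤-Reasoning
  restWeight : weight (c ⊖ u) % 5 ≡ weight u % 5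
  restWeight = halving (weight u) (weight (c ⊖ u))
    (trans weight≡ (cong (λ r → (3 * r) % 5) (trans (cong weight (sym u⊕rest)) (weight-⊕ u (c ⊖ u)))))

smallCase : ℕ → ℕ → ℕ → ℕ → ℕ → Bool
smallCase z a b c d = let v = mkCounts z a b c d in
  ((nonzeroSize v ≤ᵇ 5) ∧ (2 ≤ᵇ size v)) ⇒ᵇ (hasShape v ∨ splittable v)

smallCheck : T (allBelow 3 λ z → allBelow⁴ 6 (smallCase z))
smallCheck = _

small⇒split : ∀ z a b c d → z < 3 → let v = mkCounts z a b c d in
  nonzeroSize v ≤ 5 → 2 ≤ size v → T (not (hasShape v)) → Split v
small⇒split z a b c d z<3 few 2≤size ¬shape =
  shapeOrSplit (to (T-∨ {hasShape v}) (⇒ᵇ-elim {(nonzeroSize v ≤ᵇ 5) ∧ (2 ≤ᵇ size v)} check sizes))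
  where
  v = mkCounts z a b c d
  sizes : T ((nonzeroSize v ≤ᵇ 5) ∧ (2 ≤ᵇ size v))
  sizes = from T-∧ (≤⇒≤ᵇ few , ≤⇒≤ᵇ 2≤size)
  bounds = nonzero-bounds z a b c d few
  check : T (smallCase z a b c d)
  check = allBelow⁴-sound 6 (smallCase z) (allBelow-sound 3 (λ z → allBelow⁴ 6 (smallCase z)) smallCheck z z<3)
    a b c d (s≤s (proj₁ bounds)) (s≤s (proj₁ (proj₂ bounds)))
    (s≤s (proj₁ (proj₂ (proj₂ bounds)))) (s≤s (proj₂ (proj₂ (proj₂ bounds))))
  shapeOrSplit : T (hasShape (mkCounts z a b c d)) ⊎ T (splittable (mkCounts z a b c d)) → Split (mkCounts z a b c d)
  shapeOrSplit (inj₁ shape) = ⊥-elim (T-not shape ¬shape)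
  shapeOrSplit (inj₂ split) = splittable-sound _ split

-- Only whether there are zeros matters for the forms, and extra zeros can join any block,
-- so the case of few nonzero elements reduces to at most two zeros.
fewNonzeros⇒split : ∀ c → nonzeroSize c ≤ 5 → 2 ≤ size c → T (not (hasShape c)) → Split c
fewNonzeros⇒split (mkCounts 0 a b c d) = small⇒split 0 a b c d (s≤s z≤n)
fewNonzeros⇒split (mkCounts 1 a b c d) = small⇒split 1 a b c d (s≤s (s≤s z≤n))
fewNonzeros⇒split (mkCounts 2 a b c d) = small⇒split 2 a b c d (s≤s (s≤s (s≤s z≤n)))
fewNonzeros⇒split (mkCounts (suc (suc (suc z))) a b c d) few _ ¬shape =
  subst Split (cong₅ refl (+-identityʳ a) (+-identityʳ b) (+-identityʳ c) (+-identityʳ d))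
    (Split-addZeros (mkCounts 2 a b c d) (suc z) (small⇒split 2 a b c d (s≤s (s≤s (s≤s z≤n))) few (s≤s (s≤s z≤n)) ¬shape))

¬shape⇒split : ∀ c → T (not (hasShape c)) → 2 ≤ size c → Split c
¬shape⇒split c ¬shape 2≤size with 6 ≤? nonzeroSize c
... | yes many = manyNonzeros⇒split c many
... | no ¬many = fewNonzeros⇒split c (s≤s⁻¹ (≰⇒> ¬many)) 2≤size ¬shape

infix 4 _≡₁₁_ _≡₁₁ᵇ_

prime[11] : Prime 11
prime[11] = toWitness {a? = prime? 11} _

PrimeTo11 : ℕ → Set
PrimeTo11 n = ¬ 11 ∣ n

_≡₁₁_ : ℤ → ℤ → Set
a ≡₁₁ b = a τ[ 11 ] b

-- transfer to the signed divisibility of the library, which has the closure properties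
private
  toSigned : ∀ a b → a ≡₁₁ b → + 11 Signed.∣ a ℤ.- b
  toSigned a b = Signed.∣ᵤ⇒∣ {+ 11} {a ℤ.- b}

  fromSigned : ∀ a b → + 11 Signed.∣ a ℤ.- b → a ≡₁₁ b
  fromSigned a b = Signed.∣⇒∣ᵤ {+ 11} {a ℤ.- b}

≡₁₁-sym : ∀ {a b} → a ≡₁₁ b → b ≡₁₁ a
≡₁₁-sym {a} {b} h = fromSigned b a (subst (Signed._∣_ (+ 11)) (negate a b) (Signed.∣m⇒∣-m (toSigned a b h)))
  where
  negate : ∀ a b → - (a ℤ.- b) ≡ b ℤ.- a
  negate = ℤSolver.solve-∀

≡₁₁-trans : ∀ {a b c} → a ≡₁₁ b → b ≡₁₁ c → a ≡₁₁ c
≡₁₁-trans {a} {b} {c} h₁ h₂ =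
  fromSigned a c (subst (Signed._∣_ (+ 11)) (ℤ.+-minus-telescope a b c) (Signed.∣m∣n⇒∣m+n (toSigned a b h₁) (toSigned b c h₂)))

≡₁₁-neg : ∀ {a b} → a ≡₁₁ b → - a ≡₁₁ - b
≡₁₁-neg {a} {b} h = fromSigned (- a) (- b) (subst (Signed._∣_ (+ 11)) (negate a b) (Signed.∣m⇒∣-m (toSigned a b h)))
  where
  negate : ∀ a b → - (a ℤ.- b) ≡ (- a) ℤ.- (- b)
  negate = ℤSolver.solve-∀

≡₁₁-∣ : ∀ {a b} → a ≡₁₁ b → 11 ∣ ∣ b ∣ → 11 ∣ ∣ a ∣
≡₁₁-∣ {a} {b} h 11∣b =
  Signed.∣⇒∣ᵤ {+ 11} {a} (subst (Signed._∣_ (+ 11)) (cancel a b) (Signed.∣m∣n⇒∣m+n (toSigned a b h) (Signed.∣ᵤ⇒∣ {+ 11} {b} 11∣b)))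
  where
  cancel : ∀ a b → (a ℤ.- b) ℤ.+ b ≡ a
  cancel = ℤSolver.solve-∀

∣⇒≡₁₁0 : ∀ a → 11 ∣ ∣ a ∣ → a ≡₁₁ + 0
∣⇒≡₁₁0 a h = subst (λ t → 11 ∣ ∣ t ∣) (sym (ℤ.+-identityʳ a)) h

≡₁₁-% : ∀ n → + n ≡₁₁ + (n % 11)
≡₁₁-% n = fromSigned (+ n) (+ (n % 11)) (Signed.divides (+ (n / 11)) eq)
  where
  open ≡-Reasoning
  r = n % 11
  q = n / 11
  cancel : ∀ (r q : ℤ) → (r ℤ.+ q ℤ.* + 11) ℤ.- r ≡ q ℤ.* + 11
  cancel = ℤSolver.solve-∀
  eq : + n ℤ.- + r ≡ + q ℤ.* + 11
  eq = begin
    + n ℤ.- + r                  ≡⟨ cong (λ m → + m ℤ.- + r) (m≡m%n+[m/n]*n n 11) ⟩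
    + (r + q * 11) ℤ.- + r       ≡⟨ cong (ℤ._- + r) (trans (ℤ.pos-+ r (q * 11)) (cong (λ t → (+ r) ℤ.+ t) (ℤ.pos-* q 11))) ⟩
    (+ r ℤ.+ + q ℤ.* + 11) ℤ.- + r ≡⟨ cancel (+ r) (+ q) ⟩
    + q ℤ.* + 11                 ∎

-- ±2ⁱ: every nonzero residue modulo 11 is of this form with 0 ≤ i ≤ 4.
signedPower : Bool → ℕ → ℤ
signedPower true  i = + (2 ^ i)
signedPower false i = - + (2 ^ i)

neg-signedPower : ∀ s i → - signedPower s i ≡ signedPower (not s) i
neg-signedPower true  i = refl
neg-signedPower false i = ℤ.neg-involutive _

indexTable : ℕ → ℕ
indexTable 1  = 0
indexTable 10 = 0
indexTable 2  = 1
indexTable 9  = 1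
indexTable 4  = 2
indexTable 7  = 2
indexTable 3  = 3
indexTable 8  = 3
indexTable 5  = 4
indexTable 6  = 4
indexTable _  = 0

classIndex : ℕ → ℕ
classIndex n = indexTable (n % 11)

_≡₁₁ᵇ_ : ℤ → ℤ → Bool
a ≡₁₁ᵇ b = ∣ a ℤ.- b ∣ % 11 ≡ᵇ 0

≡₁₁ᵇ⇒≡₁₁ : ∀ a b → T (a ≡₁₁ᵇ b) → a ≡₁₁ b
≡₁₁ᵇ⇒≡₁₁ a b h = m%n≡0⇒n∣m _ 11 (≡ᵇ⇒≡ _ 0 h)

≡₁₁⇒≡₁₁ᵇ : ∀ a b → a ≡₁₁ b → T (a ≡₁₁ᵇ b)
≡₁₁⇒≡₁₁ᵇ a b h = ≡⇒≡ᵇ _ 0 (n∣m⇒m%n≡0 _ 11 h)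

forBoth : (Bool → Bool) → Bool
forBoth f = f true ∧ f false

forBoth-sound : ∀ f → T (forBoth f) → ∀ s → T (f s)
forBoth-sound f h true  = proj₁ (to (T-∧ {f true}) h)
forBoth-sound f h false = proj₂ (to (T-∧ {f true}) h)

classIndex≤4 : ∀ n → classIndex n ≤ 4
classIndex≤4 n = ≤ᵇ⇒≤ _ 4 (allBelow-sound 11 (λ r → indexTable r ≤ᵇ 4) _ (n % 11) (m%n<n n 11))

isSignedPower : ℕ → Bool
isSignedPower r = (+ r ≡₁₁ᵇ signedPower true (indexTable r)) ∨ (+ r ≡₁₁ᵇ signedPower false (indexTable r))

representativeCheck : T (allBelow 11 λ r → (r ≡ᵇ 0) ∨ isSignedPower r)
representativeCheck = _

representative : ∀ n → PrimeTo11 n → Σ Bool λ s → + n ≡₁₁ signedPower s (classIndex n)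
representative n 11∤n
  with to (T-∨ {n % 11 ≡ᵇ 0}) (allBelow-sound 11 (λ r → (r ≡ᵇ 0) ∨ isSignedPower r) representativeCheck (n % 11) (m%n<n n 11))
... | inj₁ r≡0 = ⊥-elim (11∤n (m%n≡0⇒n∣m n 11 (≡ᵇ⇒≡ _ 0 r≡0)))
... | inj₂ h with to (T-∨ {+ (n % 11) ≡₁₁ᵇ signedPower true (classIndex n)}) h
... | inj₁ plus  = true  , via (≡₁₁ᵇ⇒≡₁₁ (+ (n % 11)) (signedPower true (classIndex n)) plus)
  where via = ≡₁₁-trans {+ n} {+ (n % 11)} {signedPower true (classIndex n)} (≡₁₁-% n)
... | inj₂ minus = false , via (≡₁₁ᵇ⇒≡₁₁ (+ (n % 11)) (signedPower false (classIndex n)) minus)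
  where via = ≡₁₁-trans {+ n} {+ (n % 11)} {signedPower false (classIndex n)} (≡₁₁-% n)

hasClassIndex : ∀ n → PrimeTo11 n → HasClassIndex n (classIndex n)
hasClassIndex n 11∤n with representative n 11∤n
... | true  , h = classIndex≤4 n , inj₁ h
... | false , h = classIndex≤4 n , inj₂ h

signedPowerCheck : T (forBoth λ s → forBoth λ s′ → allBelow 5 λ i → allBelow 5 λ j →
  (signedPower s i ≡₁₁ᵇ signedPower s′ j) ⇒ᵇ (i ≡ᵇ j))
signedPowerCheck = _

signedPower-injective : ∀ s s′ i j → i ≤ 4 → j ≤ 4 → signedPower s i ≡₁₁ signedPower s′ j → i ≡ j
signedPower-injective s s′ i j i≤4 j≤4 h = ≡ᵇ⇒≡ i j (⇒ᵇ-elim atIJ (≡₁₁⇒≡₁₁ᵇ (signedPower s i) (signedPower s′ j) h))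
  where
  check : ℕ → ℕ → Bool
  check i j = (signedPower s i ≡₁₁ᵇ signedPower s′ j) ⇒ᵇ (i ≡ᵇ j)
  atSigns = forBoth-sound (λ s′ → allBelow 5 λ i → allBelow 5 (λ j → (signedPower s i ≡₁₁ᵇ signedPower s′ j) ⇒ᵇ (i ≡ᵇ j)))
              (forBoth-sound (λ s → forBoth λ s′ → allBelow 5 λ i → allBelow 5 λ j →
                 (signedPower s i ≡₁₁ᵇ signedPower s′ j) ⇒ᵇ (i ≡ᵇ j)) signedPowerCheck s) s′
  atIJ = allBelow-sound 5 (check i) (allBelow-sound 5 (λ i → allBelow 5 (check i)) atSigns i (s≤s i≤4)) j (s≤s j≤4)

classIndex-unique : ∀ p r → HasClassIndex p r → PrimeTo11 p → r ≡ classIndex p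
classIndex-unique p r (r≤4 , h) 11∤p with asSignedPower h | representative p 11∤p
  where
  asSignedPower : + p ≡₁₁ + (2 ^ r) ⊎ + p ≡₁₁ - + (2 ^ r) → Σ Bool λ s → + p ≡₁₁ signedPower s r
  asSignedPower (inj₁ plus)  = true , plus
  asSignedPower (inj₂ minus) = false , minus
... | s , p≡±2ʳ | s′ , p≡±2ⁱ = signedPower-injective s s′ r (classIndex p) r≤4 (classIndex≤4 p)
  (≡₁₁-trans {signedPower s r} {+ p} {signedPower s′ (classIndex p)} (≡₁₁-sym {+ p} {signedPower s r} p≡±2ʳ) p≡±2ⁱ)

representativeℤ : ∀ a → PrimeTo11 ∣ a ∣ → Σ Bool λ s → a ≡₁₁ signedPower s (classIndex ∣ a ∣)
representativeℤ (+ n) 11∤n = representative n 11∤n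
representativeℤ a@(-[1+ n ]) 11∤a with representative ∣ a ∣ 11∤a
... | s , h = not s , subst (a ≡₁₁_) (neg-signedPower s _) (≡₁₁-neg {+ ∣ a ∣} {signedPower s (classIndex ∣ a ∣)} h)

classIndex-≡₁₁ : ∀ a b → a ≡₁₁ b → PrimeTo11 ∣ a ∣ → PrimeTo11 ∣ b ∣ → classIndex ∣ a ∣ ≡ classIndex ∣ b ∣
classIndex-≡₁₁ a b a≡b 11∤a 11∤b with representativeℤ a 11∤a | representativeℤ b 11∤b
... | s , ha | t , hb = signedPower-injective s t _ _ (classIndex≤4 ∣ a ∣) (classIndex≤4 ∣ b ∣)
  (≡₁₁-trans {signedPower s (classIndex ∣ a ∣)} {a} (≡₁₁-sym {a} ha) (≡₁₁-trans {a} {b} a≡b hb))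

signedRepresentative : ∀ n → PrimeTo11 n → Σ ℤ λ a → ∣ a ∣ ≡ n × a ≡₁₁ signedPower true (classIndex n)
signedRepresentative n 11∤n with representative n 11∤n
... | true  , h = + n , refl , h
... | false , h = - + n , ℤ.∣-i∣≡∣i∣ (+ n) ,
  subst (- + n ≡₁₁_) (ℤ.neg-involutive _) (≡₁₁-neg {+ n} {signedPower false (classIndex n)} h)

multiplicativityCheck : T (allBelow 11 λ r → allBelow 11 λ s → (not (r ≡ᵇ 0) ∧ not (s ≡ᵇ 0)) ⇒ᵇ
  (indexTable ((r * s) % 11) ≡ᵇ (indexTable r + indexTable s) % 5))
multiplicativityCheck = _

%11≢0 : ∀ n → PrimeTo11 n → T (not (n % 11 ≡ᵇ 0))
%11≢0 n 11∤n = ¬T⇒T-not (λ h → 11∤n (m%n≡0⇒n∣m n 11 (≡ᵇ⇒≡ _ 0 h)))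

classIndex-* : ∀ m n → PrimeTo11 m → PrimeTo11 n → classIndex (m * n) ≡ (classIndex m + classIndex n) % 5
classIndex-* m n 11∤m 11∤n = trans (cong indexTable (%-distribˡ-* m n 11))
  (≡ᵇ⇒≡ _ _ (⇒ᵇ-elim atMN (from T-∧ (%11≢0 m 11∤m , %11≢0 n 11∤n))))
  where
  check : ℕ → ℕ → Bool
  check r s = (not (r ≡ᵇ 0) ∧ not (s ≡ᵇ 0)) ⇒ᵇ (indexTable ((r * s) % 11) ≡ᵇ (indexTable r + indexTable s) % 5)
  atMN = allBelow-sound 11 (check (m % 11))
    (allBelow-sound 11 (λ r → allBelow 11 (check r)) multiplicativityCheck (m % 11) (m%n<n m 11)) (n % 11) (m%n<n n 11)

prime∣product : ∀ {p} ns → Prime p → p ∣ prodℕ ns → Any (p ∣_) ns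
prime∣product []       pp p∣1 = ⊥-elim (¬prime[1] (subst Prime (∣1⇒≡1 p∣1) pp))
prime∣product (n ∷ ns) pp p∣n*ns with euclidsLemma n (prodℕ ns) pp p∣n*ns
... | inj₁ p∣n  = here p∣n
... | inj₂ p∣ns = there (prime∣product ns pp p∣ns)

product-primeTo11 : ∀ ns → All PrimeTo11 ns → PrimeTo11 (prodℕ ns)
product-primeTo11 ns hs 11∣ns = All¬⇒¬Any hs (prime∣product ns prime[11] 11∣ns)

factors-primeTo11 : ∀ ns x → prodℕ ns ≡ x → PrimeTo11 x → All PrimeTo11 ns
factors-primeTo11 ns x eq 11∤x = All.tabulate λ n∈ns 11∣n → 11∤x (subst (11 ∣_) eq (∣-trans 11∣n (∈⇒∣product n∈ns)))

ProperFactorizable : ℕ → Set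
ProperFactorizable x = ∃[ as ] ProperTauFactorization 11 (+ x) as

indexMultiset : List ℕ → Counts
indexMultiset = tallyOf classIndex classIndex≤4

indexMultiset-concat : ∀ Bs → indexMultiset (concat Bs) ≡ sumCounts (map indexMultiset Bs)
indexMultiset-concat []       = refl
indexMultiset-concat (B ∷ Bs) = begin
  tally (map classIndex (B ++ concat Bs))                      ≡⟨ cong tally (map-++ classIndex B (concat Bs)) ⟩
  tally (map classIndex B ++ map classIndex (concat Bs))       ≡⟨ tally-++ (map classIndex B) _ ⟩
  indexMultiset B ⊕ indexMultiset (concat Bs)                  ≡⟨ cong (indexMultiset B ⊕_) (indexMultiset-concat Bs) ⟩
  indexMultiset B ⊕ sumCounts (map indexMultiset Bs)           ∎
  where open ≡-Reasoning

product-concat : ∀ Bs → prodℕ (concat Bs) ≡ prodℕ (map prodℕ Bs)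
product-concat []       = refl
product-concat (B ∷ Bs) = trans (product-++ B (concat Bs)) (cong (prodℕ B *_) (product-concat Bs))

indexMultiset-↭ : ∀ {ps qs} → ps ↭ qs → indexMultiset ps ≡ indexMultiset qs
indexMultiset-↭ p = tally-↭ (Perm.map⁺ classIndex p)

classIndex-product : ∀ B → All PrimeTo11 B → classIndex (prodℕ B) ≡ weight (indexMultiset B) % 5
classIndex-product []      []        = refl
classIndex-product (p ∷ B) (hp ∷ hB) = begin
  classIndex (p * prodℕ B)                              ≡⟨ classIndex-* p (prodℕ B) hp (product-primeTo11 B hB) ⟩
  (classIndex p + classIndex (prodℕ B)) % 5             ≡⟨ cong (λ t → (classIndex p + t) % 5) (classIndex-product B hB) ⟩
  (classIndex p + weight (indexMultiset B) % 5) % 5     ≡⟨ %-absorbʳ (classIndex p) (weight (indexMultiset B)) ⟩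
  (classIndex p + weight (indexMultiset B)) % 5         ≡⟨ cong (λ t → (t + weight (indexMultiset B)) % 5) (weight-unit (classIndex≤4 p)) ⟨
  (weight (unit (classIndex p)) + weight (indexMultiset B)) % 5 ≡⟨ cong (_% 5) (weight-⊕ (unit (classIndex p)) _) ⟨
  weight (indexMultiset (p ∷ B)) % 5                    ∎
  where
  open ≡-Reasoning
  %-absorbʳ : ∀ a b → (a + b % 5) % 5 ≡ (a + b) % 5
  %-absorbʳ a b = trans (%-distribˡ-+ a (b % 5) 5)
    (trans (cong (λ t → (a % 5 + t) % 5) (m%n%n≡m%n b 5)) (sym (%-distribˡ-+ a b 5)))

abs-prodℤ : ∀ as → ∣ prodℤ as ∣ ≡ prodℕ (map ∣_∣ as)
abs-prodℤ []       = refl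
abs-prodℤ (a ∷ as) = trans (ℤ.abs-* a (prodℤ as)) (cong (∣ a ∣ *_) (abs-prodℤ as))

±product⇒abs : ∀ x as → (+ x ≡ prodℤ as ⊎ + x ≡ - prodℤ as) → x ≡ prodℕ (map ∣_∣ as)
±product⇒abs x as (inj₁ eq) = trans (cong ∣_∣ eq) (abs-prodℤ as)
±product⇒abs x as (inj₂ eq) = trans (cong ∣_∣ eq) (trans (ℤ.∣-i∣≡∣i∣ (prodℤ as)) (abs-prodℤ as))

abs⇒±product : ∀ x as → prodℕ (map ∣_∣ as) ≡ x → (+ x ≡ prodℤ as ⊎ + x ≡ - prodℤ as)
abs⇒±product x as eq with prodℤ as | abs-prodℤ as
... | + n      | abs≡ = inj₁ (cong +_ (trans (sym eq) (sym abs≡)))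
... | -[1+ n ] | abs≡ = inj₂ (cong +_ (trans (sym eq) (sym abs≡)))

nonzeroNonunit⇒2≤ : ∀ a → NonzeroNonunit a → 2 ≤ ∣ a ∣
nonzeroNonunit⇒2≤ (+ 0)            (a≢0 , _ , _)  with () ← a≢0 refl
nonzeroNonunit⇒2≤ (+ 1)            (_ , a≢1 , _)  with () ← a≢1 refl
nonzeroNonunit⇒2≤ (+ suc (suc n))  _              = s≤s (s≤s z≤n)
nonzeroNonunit⇒2≤ -[1+ 0 ]         (_ , _ , a≢-1) with () ← a≢-1 refl
nonzeroNonunit⇒2≤ -[1+ suc n ]     _              = s≤s (s≤s z≤n)

2≤⇒nonzeroNonunit : ∀ a → 2 ≤ ∣ a ∣ → NonzeroNonunit a
2≤⇒nonzeroNonunit (+ suc (suc n)) _ = (λ ()) , (λ ()) , (λ ())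
2≤⇒nonzeroNonunit -[1+ suc n ]    _ = (λ ()) , (λ ()) , (λ ())
2≤⇒nonzeroNonunit (+ 1)           (s≤s ())
2≤⇒nonzeroNonunit -[1+ 0 ]        (s≤s ())

2≤product : ∀ a as → All NonzeroNonunit (a ∷ as) → 2 ≤ prodℕ (map ∣_∣ (a ∷ as))
2≤product a []       (a-ok ∷ [])   = subst (2 ≤_) (sym (*-identityʳ ∣ a ∣)) (nonzeroNonunit⇒2≤ a a-ok)
2≤product a (b ∷ as) (a-ok ∷ rest) = *-mono-≤ (nonzeroNonunit⇒2≤ a a-ok) (≤-trans (s≤s z≤n) (2≤product b as rest))

pairwise-≡₁₁ : ∀ c as → All (_≡₁₁ c) as → All (λ a → All (λ b → a ≡₁₁ b) as) as
pairwise-≡₁₁ c as h = All.map (λ {a} a≡c → All.map (λ {b} b≡c → ≡₁₁-trans {a} {c} {b} a≡c (≡₁₁-sym {b} {c} b≡c)) h) h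

prime⇒2≤ : ∀ {p} → Prime p → 2 ≤ p
prime⇒2≤ {2+ _} _ = s≤s (s≤s z≤n)

blockProduct : ∀ w B → All Prime B → All PrimeTo11 B → Block w (indexMultiset B) →
  PrimeTo11 (prodℕ B) × classIndex (prodℕ B) ≡ w × 2 ≤ prodℕ B
blockProduct w (p ∷ B) (pp ∷ pB) h₁₁ (_ , weight≡) =
  product-primeTo11 (p ∷ B) h₁₁ , trans (classIndex-product (p ∷ B) h₁₁) weight≡ ,
  *-mono-≤ (prime⇒2≤ pp) (productOfPrimes≥1 pB)

chooseSigns : ∀ w ns → All (λ n → PrimeTo11 n × classIndex n ≡ w × 2 ≤ n) ns →
  Σ (List ℤ) λ as → map ∣_∣ as ≡ ns × All (_≡₁₁ signedPower true w) as × All NonzeroNonunit as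
chooseSigns w []       []                         = [] , refl , [] , []
chooseSigns w (n ∷ ns) ((11∤n , index≡ , 2≤n) ∷ hs) with signedRepresentative n 11∤n | chooseSigns w ns hs
... | a , ∣a∣≡n , a≡ | as , abs≡ , as≡ , nonunits =
  a ∷ as , cong₂ _∷_ ∣a∣≡n abs≡ , subst (λ i → a ≡₁₁ signedPower true i) index≡ a≡ ∷ as≡ ,
  2≤⇒nonzeroNonunit a (subst (2 ≤_) (sym ∣a∣≡n) 2≤n) ∷ nonunits

-- A split of the index multiset yields a proper τ₁₁-factorization: multiply the primes of each
-- block and choose the signs so that all factors are ≡ 2ʷ.
split⇒factorization : ∀ x ps → All Prime ps → prodℕ ps ≡ x → PrimeTo11 x →
  Split (indexMultiset ps) → ProperFactorizable x
split⇒factorization x ps prime-ps ps≡x 11∤x (w , vs , 2≤len , blocks , sum≡)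
  with realizeAll classIndex classIndex≤4 ps vs (sym sum≡)
... | Bs , refl , ps↭Bs with chooseSigns w (map prodℕ Bs) (All.map⁺ (blockInfo Bs primes primesTo11 (All.map⁻ blocks)))
  where
  primes : All (All Prime) Bs
  primes = All.concat⁻ (Perm.All-resp-↭ ps↭Bs prime-ps)
  primesTo11 : All (All PrimeTo11) Bs
  primesTo11 = All.concat⁻ (Perm.All-resp-↭ ps↭Bs (factors-primeTo11 ps x ps≡x 11∤x))
  blockInfo : ∀ Bs → All (All Prime) Bs → All (All PrimeTo11) Bs → All (λ B → Block w (indexMultiset B)) Bs →
    All (λ B → PrimeTo11 (prodℕ B) × classIndex (prodℕ B) ≡ w × 2 ≤ prodℕ B) Bs
  blockInfo []       []       []       []       = []
  blockInfo (B ∷ Bs) (p ∷ ps) (q ∷ qs) (b ∷ bs) = blockProduct w B p q b ∷ blockInfo Bs ps qs bs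
... | as , abs≡ , ≡2ʷ , nonunits =
  as , (abs⇒±product x as product≡ , nonunits , pairwise-≡₁₁ _ as ≡2ʷ) , subst (2 ≤_) length≡ 2≤len
  where
  open ≡-Reasoning
  product≡ : prodℕ (map ∣_∣ as) ≡ x
  product≡ = begin
    prodℕ (map ∣_∣ as)          ≡⟨ cong prodℕ abs≡ ⟩
    prodℕ (map prodℕ Bs)        ≡⟨ product-concat Bs ⟨
    prodℕ (concat Bs)           ≡⟨ product-↭ (↭-sym ps↭Bs) ⟩
    prodℕ ps                    ≡⟨ ps≡x ⟩
    x                           ∎
  length≡ : length (map indexMultiset Bs) ≡ length as
  length≡ = begin
    length (map indexMultiset Bs) ≡⟨ length-map indexMultiset Bs ⟩
    length Bs                     ≡⟨ length-map prodℕ Bs ⟨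
    length (map prodℕ Bs)         ≡⟨ cong length abs≡ ⟨
    length (map ∣_∣ as)           ≡⟨ length-map ∣_∣ as ⟩
    length as                     ∎

primeBlock : ∀ w n → 2 ≤ n → PrimeTo11 n → classIndex n ≡ w →
  Σ (List ℕ) λ B → All Prime B × prodℕ B ≡ n × Block w (indexMultiset B)
primeBlock w n@(suc n-1) 2≤n 11∤n index≡ =
  B , PrimeFactorisation.factorsPrime f , B≡n , nonempty B B≡n , weight≡
  where
  f = factorise n
  B = PrimeFactorisation.factors f
  B≡n : prodℕ B ≡ n
  B≡n = sym (PrimeFactorisation.isFactorisation f)
  nonempty : ∀ B → prodℕ B ≡ n → 1 ≤ size (indexMultiset B)
  nonempty []      1≡n  with s≤s () ← subst (2 ≤_) (sym 1≡n) 2≤n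
  nonempty (p ∷ B) _    = subst (1 ≤_) (sym (size-tallyOf classIndex classIndex≤4 (p ∷ B))) (s≤s z≤n)
  weight≡ : weight (indexMultiset B) % 5 ≡ w
  weight≡ = trans (sym (classIndex-product B (factors-primeTo11 B n B≡n 11∤n))) (trans (cong classIndex B≡n) index≡)

commonIndex : ∀ a₀ → PrimeTo11 ∣ a₀ ∣ → ∀ as → All (a₀ ≡₁₁_) as → All (λ a → PrimeTo11 ∣ a ∣) as →
  All (λ a → classIndex ∣ a ∣ ≡ classIndex ∣ a₀ ∣) as
commonIndex a₀ 11∤a₀ []       []           []           = []
commonIndex a₀ 11∤a₀ (a ∷ as) (a₀≡a ∷ a₀≡) (11∤a ∷ 11∤) =
  sym (classIndex-≡₁₁ a₀ a a₀≡a 11∤a₀ 11∤a) ∷ commonIndex a₀ 11∤a₀ as a₀≡ 11∤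

-- Factoring every factor into primes turns a proper τ₁₁-factorization into a split of the
-- index multiset; by uniqueness of prime factorization the primes used are exactly ps.
factorization⇒split : ∀ x ps → All Prime ps → prodℕ ps ≡ x → PrimeTo11 x →
  ProperFactorizable x → Split (indexMultiset ps)
factorization⇒split x ps prime-ps ps≡x 11∤x (as@(a₀ ∷ _) , (±x , nonunits , a₀≡ ∷ _) , 2≤len) =
  classIndex ∣ a₀ ∣ , map indexMultiset Bs , subst (2 ≤_) length≡ 2≤len , All.map⁺ blocks , sum≡
  where
  open ≡-Reasoning
  x≡ : x ≡ prodℕ (map ∣_∣ as)
  x≡ = ±product⇒abs x as ±x
  11∤as : All (λ a → PrimeTo11 ∣ a ∣) as
  11∤as = All.map⁻ (factors-primeTo11 (map ∣_∣ as) x (sym x≡) 11∤x)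
  w = classIndex ∣ a₀ ∣
  factorBlocks : ∀ as → All NonzeroNonunit as → All (λ a → PrimeTo11 ∣ a ∣) as → All (λ a → classIndex ∣ a ∣ ≡ w) as →
    Σ (List (List ℕ)) λ Bs → All (All Prime) Bs × map prodℕ Bs ≡ map ∣_∣ as × All (λ B → Block w (indexMultiset B)) Bs
  factorBlocks []       []       []       []       = [] , [] , refl , []
  factorBlocks (a ∷ as) (n ∷ ns) (h ∷ hs) (i ∷ is) with primeBlock w ∣ a ∣ (nonzeroNonunit⇒2≤ a n) h i | factorBlocks as ns hs is
  ... | B , pB , B≡a , bB | Bs , pBs , Bs≡as , bBs = B ∷ Bs , pB ∷ pBs , cong₂ _∷_ B≡a Bs≡as , bB ∷ bBs
  found = factorBlocks as nonunits 11∤as (commonIndex a₀ (All.head 11∤as) as a₀≡ 11∤as)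
  Bs = proj₁ found
  primes = proj₁ (proj₂ found)
  Bs≡as = proj₁ (proj₂ (proj₂ found))
  blocks = proj₂ (proj₂ (proj₂ found))
  concat≡x : x ≡ prodℕ (concat Bs)
  concat≡x = trans x≡ (trans (cong prodℕ (sym Bs≡as)) (sym (product-concat Bs)))
  concat↭ps : concat Bs ↭ ps
  concat↭ps = factorisationUnique
    record { factors = concat Bs ; isFactorisation = concat≡x ; factorsPrime = All.concat⁺ primes }
    record { factors = ps ; isFactorisation = sym ps≡x ; factorsPrime = prime-ps }
  sum≡ : sumCounts (map indexMultiset Bs) ≡ indexMultiset ps
  sum≡ = trans (sym (indexMultiset-concat Bs)) (indexMultiset-↭ concat↭ps)
  length≡ : length as ≡ length (map indexMultiset Bs)
  length≡ = begin
    length as                     ≡⟨ length-map ∣_∣ as ⟨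
    length (map ∣_∣ as)           ≡⟨ cong length Bs≡as ⟨
    length (map prodℕ Bs)         ≡⟨ length-map prodℕ Bs ⟩
    length Bs                     ≡⟨ length-map indexMultiset Bs ⟨
    length (map indexMultiset Bs) ∎

-- A prime has no proper factorization at all: one factor would have absolute value 1.
prime⇒noFactorization : ∀ x → Prime x → ¬ ProperFactorizable x
prime⇒noFactorization x px (_ ∷ [] , _ , s≤s ())
prime⇒noFactorization x px (a ∷ b ∷ rest , (±x , a-ok ∷ b-ok ∷ rest-ok , _) , _)
  with prime⇒irreducible px (divides R (trans x≡ (*-comm ∣ a ∣ R)))
  where
  R = prodℕ (map ∣_∣ (b ∷ rest))
  x≡ : x ≡ ∣ a ∣ * R
  x≡ = ±product⇒abs x (a ∷ b ∷ rest) ±x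
... | inj₁ ∣a∣≡1 with s≤s () ← subst (2 ≤_) ∣a∣≡1 (nonzeroNonunit⇒2≤ a a-ok)
... | inj₂ ∣a∣≡x = <-irrefl refl (begin-strict
  x                   <⟨ m<m*n x R 2≤R ⟩
  x * R               ≡⟨ cong (_* R) ∣a∣≡x ⟨
  ∣ a ∣ * R           ≡⟨ ±product⇒abs x (a ∷ b ∷ rest) ±x ⟨
  x                   ∎)
  where
  open ≤-Reasoning
  R = prodℕ (map ∣_∣ (b ∷ rest))
  instance
    x≢0 : NonZero x
    x≢0 = >-nonZero (≤-trans (s≤s z≤n) (subst (2 ≤_) ∣a∣≡x (nonzeroNonunit⇒2≤ a a-ok)))
  2≤R : 2 ≤ R
  2≤R = 2≤product b rest (b-ok ∷ rest-ok)

prime≢11⇒primeTo11 : ∀ {p} → Prime p → p ≢ 11 → PrimeTo11 p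
prime≢11⇒primeTo11 pp p≢11 11∣p with prime⇒irreducible pp 11∣p
... | inj₂ 11≡p = p≢11 (sym 11≡p)

11∣all-factors : ∀ as → All (λ a → All (λ b → a ≡₁₁ b) as) as →
  Any (λ c → 11 ∣ ∣ c ∣) as → All (λ c → 11 ∣ ∣ c ∣) as
11∣all-factors as pairwise 11∣some with All.lookupAny pairwise 11∣some
... | c≡ , 11∣c = All.map (λ {d} c≡d → ≡₁₁-∣ {d} {c} (≡₁₁-sym {c} {d} c≡d) 11∣c) c≡
  where c = Any.lookup 11∣some

11²∣product : ∀ a b rest → All (λ c → 11 ∣ ∣ c ∣) (a ∷ b ∷ rest) → 11 * 11 ∣ prodℕ (map ∣_∣ (a ∷ b ∷ rest))
11²∣product a b rest (11∣a ∷ 11∣b ∷ _) =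
  ∣-trans (*-pres-∣ 11∣a 11∣b) (subst (∣ a ∣ * ∣ b ∣ ∣_) (*-assoc ∣ a ∣ ∣ b ∣ _) (m∣m*n (prodℕ (map ∣_∣ rest))))

-- (II) x = 11·p₁⋯pₖ is an atom: 11 divides some factor, hence all factors, so 11² ∣ x;
-- but 11 ∤ p₁⋯pₖ.
caseII⇒noFactorization : ∀ x → CaseII x → ¬ ProperFactorizable x
caseII⇒noFactorization x _ (_ ∷ [] , _ , s≤s ())
caseII⇒noFactorization x (ps , ps-ok , x≡11P) (as@(a ∷ b ∷ rest) , (±x , _ , pairwise) , _) =
  11∤P (*-cancelˡ-∣ 11 (subst (11 * 11 ∣_) (trans (sym x≡) x≡11P) 121∣x))
  where
  x≡ : x ≡ prodℕ (map ∣_∣ as)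
  x≡ = ±product⇒abs x as ±x
  11∣some : Any (λ c → 11 ∣ ∣ c ∣) as
  11∣some = AnyP.map⁻ (prime∣product (map ∣_∣ as) prime[11]
    (subst (11 ∣_) x≡ (divides (prodℕ ps) (trans x≡11P (*-comm 11 (prodℕ ps))))))
  121∣x : 11 * 11 ∣ prodℕ (map ∣_∣ as)
  121∣x = 11²∣product a b rest (11∣all-factors as pairwise 11∣some)
  11∤P : PrimeTo11 (prodℕ ps)
  11∤P = product-primeTo11 ps (All.map (λ {p} p-ok → prime≢11⇒primeTo11 (proj₁ p-ok) (proj₂ p-ok)) ps-ok)

classIndices : ∀ ps → All PrimeTo11 ps → Pointwise HasClassIndex ps (map classIndex ps)
classIndices []       []         = []
classIndices (p ∷ ps) (11∤p ∷ hs) = hasClassIndex p 11∤p ∷ classIndices ps hs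

classIndices-unique : ∀ ps rs → Pointwise HasClassIndex ps rs → All PrimeTo11 ps → map classIndex ps ≡ rs
classIndices-unique []       []       []       []         = refl
classIndices-unique (p ∷ ps) (r ∷ rs) (h ∷ hs) (11∤p ∷ ns) =
  cong₂ _∷_ (sym (classIndex-unique p r h 11∤p)) (classIndices-unique ps rs hs ns)

-- (III) If T(x) has one of the forms, a proper factorization would split T(x).
caseIII⇒noFactorization : ∀ x → CaseIII x → ¬ ProperFactorizable x
caseIII⇒noFactorization x (11∤x , ps , rs , ms , prime-ps , ps≡x , indices , rs↭ms , shape) factorization =
  shape⇒unsplittable (tally ms) (hasShape-complete shape) (subst Split T≡ (factorization⇒split x ps prime-ps ps≡x 11∤x factorization))
  where
  T≡ : indexMultiset ps ≡ tally ms
  T≡ = trans (cong tally (classIndices-unique ps rs indices (factors-primeTo11 ps x ps≡x 11∤x))) (tally-↭ rs↭ms)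

shape⇒caseIII : ∀ x ps → PrimeTo11 x → All Prime ps → prodℕ ps ≡ x → T (hasShape (indexMultiset ps)) → CaseIII x
shape⇒caseIII x ps 11∤x prime-ps ps≡x shape =
  let ms , shape-ms , canonical↭ms = hasShape-sound (indexMultiset ps) shape
  in 11∤x , ps , map classIndex ps , ms , prime-ps , ps≡x ,
     classIndices ps (factors-primeTo11 ps x ps≡x 11∤x) ,
     ↭-trans (↭-canonical (All.map⁺ (All.universal classIndex≤4 ps))) canonical↭ms , shape-ms

-- An atom prime to 11 is a prime or of type (III): otherwise T(x) splits by the combinatorial
-- classification, and a split gives a proper factorization.
primeTo11-atom : ∀ x → 1 < x → PrimeTo11 x → ¬ ProperFactorizable x → Prime x ⊎ CaseIII x
primeTo11-atom x@(suc _) 1<x 11∤x noFactorization =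
  classify (PrimeFactorisation.factors f) (PrimeFactorisation.factorsPrime f) (sym (PrimeFactorisation.isFactorisation f))
  where
  f = factorise x
  classify : ∀ ps → All Prime ps → prodℕ ps ≡ x → Prime x ⊎ CaseIII x
  classify []               _         1≡x  = ⊥-elim (<-irrefl 1≡x 1<x)
  classify (p ∷ [])         (pp ∷ []) p≡x  = inj₁ (subst Prime (trans (sym (*-identityʳ p)) p≡x) pp)
  classify ps@(_ ∷ _ ∷ _)   prime-ps  ps≡x = byShape (T? (hasShape (indexMultiset ps)))
    where
    byShape : Dec (T (hasShape (indexMultiset ps))) → Prime x ⊎ CaseIII x
    byShape (yes shape)  = inj₂ (shape⇒caseIII x ps 11∤x prime-ps ps≡x shape)
    byShape (no ¬shape) = ⊥-elim (noFactorization (split⇒factorization x ps prime-ps ps≡x 11∤x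
      (¬shape⇒split (indexMultiset ps) (¬T⇒T-not ¬shape)
        (subst (2 ≤_) (sym (size-tallyOf classIndex classIndex≤4 ps)) (s≤s (s≤s z≤n))))))

-- An atom divisible by 11 is of type (II): writing x = 11y, if 11 ∣ y then x = 11 · y is a
-- proper factorization into multiples of 11; otherwise y is a product of primes ≠ 11.
multipleOf11-atom : ∀ x → 1 < x → 11 ∣ x → ¬ ProperFactorizable x → CaseII x
multipleOf11-atom x 1<x (divides 0 x≡0) _ with () ← subst (1 <_) x≡0 1<x
multipleOf11-atom x 1<x (divides y@(suc _) x≡y*11) noFactorization = byDivisibility (11 ∣? y)
  where
  byDivisibility : Dec (11 ∣ y) → CaseII x
  byDivisibility (yes 11∣y) = ⊥-elim (noFactorization (+ 11 ∷ + y ∷ [] ,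
    (abs⇒±product x (+ 11 ∷ + y ∷ []) product≡ , nonunits ,
     pairwise-≡₁₁ (+ 0) _ (∣⇒≡₁₁0 (+ 11) ∣-refl ∷ ∣⇒≡₁₁0 (+ y) 11∣y ∷ [])) , s≤s (s≤s z≤n)))
    where
    product≡ : 11 * (y * 1) ≡ x
    product≡ = trans (cong (11 *_) (*-identityʳ y)) (trans (*-comm 11 y) (sym x≡y*11))
    nonunits : All NonzeroNonunit (+ 11 ∷ + y ∷ [])
    nonunits = 2≤⇒nonzeroNonunit (+ 11) (s≤s (s≤s z≤n)) ∷
               2≤⇒nonzeroNonunit (+ y) (≤-trans (s≤s (s≤s z≤n)) (∣⇒≤ 11∣y)) ∷ []
  byDivisibility (no 11∤y) =
    ps , All.zip (PrimeFactorisation.factorsPrime f , All.map primeTo11⇒≢11 (factors-primeTo11 ps y ps≡y 11∤y)) ,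
    trans x≡y*11 (trans (*-comm y 11) (cong (11 *_) (sym ps≡y)))
    where
    f = factorise y
    ps = PrimeFactorisation.factors f
    ps≡y : prodℕ ps ≡ y
    ps≡y = sym (PrimeFactorisation.isFactorisation f)
    primeTo11⇒≢11 : ∀ {p} → PrimeTo11 p → p ≢ 11
    primeTo11⇒≢11 11∤p refl = 11∤p ∣-refl

atom⇒classified : ∀ x → 1 < x → TauAtom 11 (+ x) → Prime x ⊎ CaseII x ⊎ CaseIII x
atom⇒classified x 1<x (_ , noFactorization) with 11 ∣? x
... | yes 11∣x = inj₂ (inj₁ (multipleOf11-atom x 1<x 11∣x noFactorization))
... | no 11∤x  = map₂ inj₂ (primeTo11-atom x 1<x 11∤x noFactorization)

classified⇒atom : ∀ x → 1 < x → Prime x ⊎ CaseII x ⊎ CaseIII x → TauAtom 11 (+ x)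
classified⇒atom x 1<x (inj₁ x-prime)        = 2≤⇒nonzeroNonunit (+ x) 1<x , prime⇒noFactorization x x-prime
classified⇒atom x 1<x (inj₂ (inj₁ caseII))  = 2≤⇒nonzeroNonunit (+ x) 1<x , caseII⇒noFactorization x caseII
classified⇒atom x 1<x (inj₂ (inj₂ caseIII)) = 2≤⇒nonzeroNonunit (+ x) 1<x , caseIII⇒noFactorization x caseIII

theorem11 : (x : ℕ) → 1 < x →
    TauAtom 11 (+ x) ⇔ (Prime x ⊎ CaseII x ⊎ CaseIII x)
theorem11 x 1<x = mk⇔ (atom⇒classified x 1<x) (classified⇒atom x 1<x)
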